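{- For all positive integers $k$ and $r$ there exist $k'=k'(k,r)$ and $K=K(k,r)$ such that for every $p\in(0,1)$ and every hypergraph $\Gamma=(\Omega,\mathcal X)$ all of whose edges have size at most $r$, \[\Delta_{k'}/\Delta_k\le K\cdot\max\{D(\Gamma,p),D(\Gamma,p)^{k'}\},\] i.e. $\Delta_{k'}\le K\max\{D(\Gamma,p),D(\Gamma,p)^{k'}\}\,\Delta_k$.
   Context: $\Omega$ is finite; $\Omega_p$ is the random subset containing each element independently with probability $p$. Edges are ordered $\gamma_1,\dots,\gamma_N$; $X_i$ is the indicator of $\gamma_i\subseteq\Omega_p$, $X_V=\prod_{i\in V}X_i$. The dependency graph on $[N]$ joins $i\ne j$ iff $\gamma_i\cap\gamma_j\ne\emptyset$; $\mathcal C_k$ is the family of $k$-element $V\subseteq[N]$ inducing a connected subgraph, and $\Delta_k=\sum_{V\in\mathcal C_k}\mathbb E[X_V]$. For $\Omega'\subseteq\Omega$ and $j\ge1$, $d_j(\Omega')=|\{\gamma\in\mathcal X:\Omega'\subseteq\gamma,|\gamma|=|\Omega'|+j\}|$ and $D(\Gamma,p)=\max_{j\ge1}\max_{\emptyset\ne\Omega'\subseteq\Omega}d_j(\Omega')p^j$.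
   Formalization: The probability p ranges only over the rationals in (0,1). -}

module Defs where

open import Data.Bool using (Bool; true; false; _∧_; _∨_; not; if_then_else_)
open import Data.Nat as ℕ using (ℕ; zero; suc)
open import Data.Fin using (Fin)
open import Data.Fin.Subset using (Subset; inside; outside; _∩_; _∪_; ∣_∣; ⊥)
open import Data.List using (List; []; _∷_; _++_; map; filter; foldr; length; allFin; upTo; concatMap)
open import Data.Bool.ListAction using (any; all)
open import Data.Integer using (+_)
open import Data.Vec as Vec using (Vec; []; _∷_; toList; zipWith)
open import Data.Rational using (ℚ; 0ℚ; 1ℚ; _*_; _+_; _⊔_)
open import Relation.Nullary.Decidable using (⌊_⌋)
import Data.Fin as F

_^ℚ_ : ℚ → ℕ → ℚ
p ^ℚ zero = 1ℚ
p ^ℚ suc m = p * (p ^ℚ m)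

allSubsets : (n : ℕ) → List (Subset n)
allSubsets zero = [] ∷ []
allSubsets (suc n) = map (inside ∷_) (allSubsets n) ++ map (outside ∷_) (allSubsets n)

_⊆ᵇ_ : ∀ {n} → Subset n → Subset n → Bool
[] ⊆ᵇ [] = true
(x ∷ p) ⊆ᵇ (y ∷ q) = (not x ∨ y) ∧ (p ⊆ᵇ q)

nonemptyᵇ : ∀ {n} → Subset n → Bool
nonemptyᵇ p = any (λ b → b) (toList p)

_∈ᵇ_ : ∀ {n} → Fin n → Subset n → Bool
i ∈ᵇ p = Vec.lookup p i

sumℚ : List ℚ → ℚ
sumℚ = foldr _+_ 0ℚ

maxℚ : List ℚ → ℚ   -- maximum of a list of nonnegative rationals (0 for the empty list)
maxℚ = foldr _⊔_ 0ℚ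

module Hypergraph {n N : ℕ} (γ : Fin N → Subset n) where
  -- Ω = Fin n, edges γ_1..γ_N (γ injective = edge set 𝒳)

  adjᵇ : Fin N → Fin N → Bool
  adjᵇ i j = not ⌊ i F.≟ j ⌋ ∧ nonemptyᵇ (γ i ∩ γ j)

  -- V induces a connected subgraph: every proper nonempty U ⊂ V has an edge to V ∖ U
  connectedᵇ : Subset N → Bool
  connectedᵇ V = all ok (allSubsets N)
    where
    ok : Subset N → Bool
    ok U = not (U ⊆ᵇ V ∧ nonemptyᵇ U ∧ not (V ⊆ᵇ U))
           ∨ any (λ i → (i ∈ᵇ U) ∧ any (λ j → (j ∈ᵇ V) ∧ not (j ∈ᵇ U) ∧ adjᵇ i j) (allFin N)) (allFin N)

  unionOf : Subset N → Subset n
  unionOf V = foldr _∪_ ⊥ (map γ (filter (λ i → Vec.lookup V i Data.Bool.≟ true) (allFin N)))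
    where import Data.Bool

  EX : ℚ → Subset N → ℚ
  EX p V = p ^ℚ ∣ unionOf V ∣

  isCk : ℕ → Subset N → Bool
  isCk k V = ⌊ ∣ V ∣ ℕ.≟ k ⌋ ∧ connectedᵇ V

  Δ : ℚ → ℕ → ℚ
  Δ p k = sumℚ (map (EX p) (filter (λ V → Data.Bool._≟_ (isCk k V) true) (allSubsets N)))
    where import Data.Bool

  d : ℕ → Subset n → ℕ
  d j Ω' = length (filter (λ i → Data.Bool._≟_ ((Ω' ⊆ᵇ γ i) ∧ ⌊ ∣ γ i ∣ ℕ.≟ ∣ Ω' ∣ ℕ.+ j ⌋) true) (allFin N))
    where import Data.Bool

  -- D(Γ,p) = max_{j ≥ 1} max_{∅ ≠ Ω' ⊆ Ω} d_j(Ω') p^j.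
  -- For j > n, d_j = 0, so it suffices to range over 1 ≤ j ≤ n (values are ≥ 0; empty max = 0).
  D : ℚ → ℚ
  D p = maxℚ (concatMap (λ j → map (λ Ω' → ((+ d (suc j) Ω') Data.Rational./ 1) * (p ^ℚ suc j))
                                  (filter (λ Ω' → Data.Bool._≟_ (nonemptyᵇ Ω') true) (allSubsets n)))
                        (upTo n))
    where import Data.Bool
          import Data.Rational

{-# OPTIONS --safe #-}
module Submission where

open import Defs
open import Data.Nat using (ℕ; _≥_)
open import Data.Fin using (Fin)
open import Data.Fin.Subset using (Subset; ∣_∣)
open import Data.Product using (Σ; _×_)
open import Data.Rational using (ℚ; 0ℚ; 1ℚ; _<_; _≤_; _*_; _⊔_)
open import Function.Definitions using (Injective)
open import Relation.Binary.PropositionalEquality using (_≡_)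

open import Data.Bool as Bool using (Bool; true; false; T; not; _∧_; _∨_)
open import Data.Bool.ListAction using (any)
open import Data.Bool.Properties using (T-∧; T-∨; T-≡)
open import Data.Empty using (⊥-elim)
open import Data.Fin using (zero; suc)
import Data.Fin as Fin
open import Data.Fin.Subset
open import Data.Fin.Subset.Properties
import Data.Integer as ℤ
import Data.Integer.Properties as ℤ
open import Data.List using (List; []; _∷_; _++_; map; filter; length; allFin; upTo; concatMap; foldl; tabulate; take; drop)
open import Data.List.Membership.Propositional using (lose) renaming (_∈_ to _∈ₗ_)
open import Data.List.Membership.Propositional.Properties
  using (∈-++⁺ˡ; ∈-++⁺ʳ; ∈-++⁻; ∈-map⁺; ∈-map⁻; ∈-∃++; ∈-filter⁺; ∈-filter⁻; ∈-allFin; ∈-upTo⁺; ∈-concatMap⁺)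
open import Data.List.Properties using (length-++; length-map; length-upTo; length-take; length-drop; take++drop≡id; foldl-++; filter-none)
open import Data.List.Relation.Binary.Sublist.Propositional using () renaming (⊆-refl to sublist-refl)
open import Data.List.Relation.Binary.Sublist.Propositional.Properties using (filter⁺; length-mono-≤)
open import Data.List.Relation.Unary.All as All using (All; []; _∷_)
import Data.List.Relation.Unary.All.Properties as All
open import Data.List.Relation.Unary.AllPairs using (_∷_)
import Data.List.Relation.Unary.Any as Any
import Data.List.Relation.Unary.Any.Properties as Any
open import Data.List.Relation.Unary.Unique.Propositional using (Unique)
import Data.List.Relation.Unary.Unique.Propositional.Properties as Unique
open import Data.Nat as ℕ using (zero; suc; _^_; z≤n; s≤s)
import Data.Nat.Coprimality as Coprimality
import Data.Nat.Properties as ℕₚ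
open import Data.Product using (_,_; ∃; ∃₂; proj₁; proj₂; uncurry)
open import Data.Rational using (_+_; _/_; mkℚ; nonNegative; *≤*)
open import Data.Rational.Properties
import Data.Rational.Unnormalised as ℚᵘ
import Data.Rational.Unnormalised.Properties as ℚᵘ
open import Data.Rational.Solver using (module +-*-Solver)
open import Data.Sum using (_⊎_; inj₁; inj₂)
import Data.Sum
open import Data.Unit using (tt)
open import Data.Vec using (Vec; []; _∷_; lookup; here; there)
import Data.Vec as Vec
open import Data.Vec.Properties using (≡-dec; []=⇒lookup; lookup⇒[]=; tabulate∘lookup)
open import Function using (_∘_; id)
open import Function.Bundles using (Equivalence)
open import Relation.Binary.Definitions using (DecidableEquality)
open import Relation.Binary.PropositionalEquality
open import Relation.Nullary using (¬_; Dec; yes; no; contradiction; ¬?; _×-dec_)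
open import Relation.Nullary.Decidable using (does; ⌊_⌋; dec-true; toWitness; fromWitness; T?)
open import Relation.Unary using (Decidable)

-- Order the k′ = k + m edges of a connected V ∈ 𝒞_k′ so that each one meets an earlier one (a
-- spanning order of the dependency graph). The first k form W ∈ 𝒞_k, and ⋃ W has at most k r
-- vertices, hence carries at most 2 ^ (k r) < k′ distinct edges; so some of the last m edges adds new
-- vertices. Thus 𝔼[X_V] = p ^ ∣⋃ V∣ is the weight of a walk of m steps from W, each step adding an
-- edge that lies inside the current vertex set S (at most 2 ^ ∣S∣ choices, weight 1) or meets S and
-- adds j ≥ 1 new vertices (total weight at most 2 ^ ∣S∣ r D), at least one step being of the second
-- kind. As V is recovered from W and the walk, summing over both gives
-- Δ_k′ ≤ K D (1 ⊔ D) ^ m Δ_k ≤ K (D ⊔ D ^ k′) Δ_k.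

private
  variable
    n : ℕ
    A B : Set

*-monoˡ-≤-0≤ : ∀ {p q} r → 0ℚ ≤ r → p ≤ q → r * p ≤ r * q
*-monoˡ-≤-0≤ r 0≤r = *-monoˡ-≤-nonNeg r {{nonNegative 0≤r}}

*-monoʳ-≤-0≤ : ∀ {p q} r → 0ℚ ≤ r → p ≤ q → p * r ≤ q * r
*-monoʳ-≤-0≤ r 0≤r = *-monoʳ-≤-nonNeg r {{nonNegative 0≤r}}

*-mono-≤-0≤ : ∀ {p q r s} → 0ℚ ≤ q → 0ℚ ≤ r → p ≤ q → r ≤ s → p * r ≤ q * s
*-mono-≤-0≤ {q = q} {r} 0≤q 0≤r p≤q r≤s = ≤-trans (*-monoʳ-≤-0≤ r 0≤r p≤q) (*-monoˡ-≤-0≤ q 0≤q r≤s)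

*-0≤ : ∀ {p q} → 0ℚ ≤ p → 0ℚ ≤ q → 0ℚ ≤ p * q
*-0≤ {p} {q} 0≤p 0≤q = ≤-trans (≤-reflexive (sym (*-zeroˡ q))) (*-monoʳ-≤-0≤ q 0≤q 0≤p)

+-0≤ : ∀ {p q} → 0ℚ ≤ p → 0ℚ ≤ q → 0ℚ ≤ p + q
+-0≤ = +-mono-≤

p≤p+q : ∀ p {q} → 0ℚ ≤ q → p ≤ p + q
p≤p+q p {q} 0≤q = ≤-trans (≤-reflexive (sym (+-identityʳ p))) (+-monoʳ-≤ p 0≤q)

p≤q+p : ∀ p {q} → 0ℚ ≤ q → p ≤ q + p
p≤q+p p {q} 0≤q = ≤-trans (p≤p+q p 0≤q) (≤-reflexive (+-comm p q))

0≤1 : 0ℚ ≤ 1ℚ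
0≤1 = *≤* (ℤ.+≤+ ℕ.z≤n)

^ℚ-0≤ : ∀ {p} → 0ℚ ≤ p → ∀ k → 0ℚ ≤ p ^ℚ k
^ℚ-0≤ 0≤p zero = 0≤1
^ℚ-0≤ 0≤p (suc k) = *-0≤ 0≤p (^ℚ-0≤ 0≤p k)

^ℚ-+ : ∀ p a b → p ^ℚ (a ℕ.+ b) ≡ p ^ℚ a * p ^ℚ b
^ℚ-+ p zero b = sym (*-identityˡ _)
^ℚ-+ p (suc a) b = trans (cong (p *_) (^ℚ-+ p a b)) (sym (*-assoc p _ _))

1^ℚ : ∀ k → 1ℚ ^ℚ k ≡ 1ℚ
1^ℚ zero = refl
1^ℚ (suc k) = trans (*-identityˡ _) (1^ℚ k)

1≤^ℚ : ∀ {p} → 1ℚ ≤ p → ∀ k → 1ℚ ≤ p ^ℚ k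
1≤^ℚ 1≤p zero = ≤-refl
1≤^ℚ 1≤p (suc k) = *-mono-≤-0≤ (≤-trans 0≤1 1≤p) 0≤1 1≤p (1≤^ℚ 1≤p k)

^ℚ-monoʳ-≤ : ∀ {p} → 1ℚ ≤ p → ∀ {a b} → a ℕ.≤ b → p ^ℚ a ≤ p ^ℚ b
^ℚ-monoʳ-≤ 1≤p {b = b} ℕ.z≤n = 1≤^ℚ 1≤p b
^ℚ-monoʳ-≤ {p} 1≤p (ℕ.s≤s a≤b) = *-monoˡ-≤-0≤ p (≤-trans 0≤1 1≤p) (^ℚ-monoʳ-≤ 1≤p a≤b)

x*[1⊔x]^m≤x⊔x^k : ∀ {x} → 0ℚ ≤ x → ∀ {m k} → m ℕ.< k → x * (1ℚ ⊔ x) ^ℚ m ≤ x ⊔ x ^ℚ k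
x*[1⊔x]^m≤x⊔x^k {x} 0≤x {m} {k} m<k with ≤-total x 1ℚ
... | inj₁ x≤1 = ≤-trans (≤-reflexive (trans (cong (λ y → x * y ^ℚ m) (p≥q⇒p⊔q≡p x≤1))
                                              (trans (cong (x *_) (1^ℚ m)) (*-identityʳ x))))
                         (p≤p⊔q x (x ^ℚ k))
... | inj₂ 1≤x = ≤-trans (≤-reflexive (cong (λ y → x * y ^ℚ m) (p≤q⇒p⊔q≡q 1≤x)))
                         (≤-trans (^ℚ-monoʳ-≤ 1≤x m<k) (p≤q⊔p x (x ^ℚ k)))

-- Written as in `Hypergraph.D`, so that its terms need no conversion.
fromℕ : ℕ → ℚ
fromℕ k = ℤ.+ k / 1

fromℕ-suc : ∀ k → fromℕ (suc k) ≡ 1ℚ + fromℕ k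
fromℕ-suc k = begin
  fromℕ (suc k)                  ≡⟨ ↥p/↧p≡p (canonical (suc k)) ⟩
  canonical (suc k)              ≡⟨ toℚᵘ-injective (ℚᵘ.≃-trans suc≃1+ (ℚᵘ.≃-sym (toℚᵘ-homo-+ (canonical 1) (canonical k)))) ⟩
  canonical 1 + canonical k      ≡⟨ sym (cong₂ _+_ (↥p/↧p≡p (canonical 1)) (↥p/↧p≡p (canonical k))) ⟩
  1ℚ + fromℕ k                   ∎
  where
  open ≡-Reasoning
  canonical : ℕ → ℚ
  canonical j = mkℚ (ℤ.+ j) 0 (Coprimality.sym (Coprimality.1-coprimeTo j))
  suc≃1+ : ℚᵘ.mkℚᵘ (ℤ.+ suc k) 0 ℚᵘ.≃ ℚᵘ.mkℚᵘ (ℤ.+ 1) 0 ℚᵘ.+ ℚᵘ.mkℚᵘ (ℤ.+ k) 0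
  suc≃1+ = ℚᵘ.*≡* (trans (ℤ.*-identityʳ (ℤ.+ suc k))
    (sym (trans (ℤ.*-identityʳ (ℤ.+ 1 ℤ.* ℤ.+ 1 ℤ.+ ℤ.+ k ℤ.* ℤ.+ 1)) (cong (λ z → ℤ.+ 1 ℤ.+ z) (ℤ.*-identityʳ (ℤ.+ k))))))

fromℕ-0≤ : ∀ k → 0ℚ ≤ fromℕ k
fromℕ-0≤ zero = ≤-refl
fromℕ-0≤ (suc k) = ≤-trans (+-0≤ 0≤1 (fromℕ-0≤ k)) (≤-reflexive (sym (fromℕ-suc k)))

fromℕ-mono-≤ : ∀ {j k} → j ℕ.≤ k → fromℕ j ≤ fromℕ k
fromℕ-mono-≤ {k = k} ℕ.z≤n = fromℕ-0≤ k
fromℕ-mono-≤ {suc j} {suc k} (ℕ.s≤s j≤k) rewrite fromℕ-suc j | fromℕ-suc k = +-monoʳ-≤ 1ℚ (fromℕ-mono-≤ j≤k)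

maxℚ-0≤ : ∀ xs → 0ℚ ≤ maxℚ xs
maxℚ-0≤ [] = ≤-refl
maxℚ-0≤ (x ∷ xs) = ≤-trans (maxℚ-0≤ xs) (p≤q⊔p x _)

∈⇒≤maxℚ : ∀ {x xs} → x ∈ₗ xs → x ≤ maxℚ xs
∈⇒≤maxℚ {x} {_ ∷ xs} (Any.here refl) = p≤p⊔q x _
∈⇒≤maxℚ {x} {y ∷ xs} (Any.there x∈xs) = ≤-trans (∈⇒≤maxℚ x∈xs) (p≤q⊔p y _)

when : Bool → ℚ → ℚ
when true x = x
when false x = 0ℚ

when-0≤ : ∀ b {x} → 0ℚ ≤ x → 0ℚ ≤ when b x
when-0≤ true 0≤x = 0≤x
when-0≤ false 0≤x = ≤-refl

when-mono-≤ : ∀ b {x y} → x ≤ y → when b x ≤ when b y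
when-mono-≤ true x≤y = x≤y
when-mono-≤ false x≤y = ≤-refl

when-does-mono-≤ : ∀ {P : Set} (P? : Dec P) {x y} → (P → x ≤ y) → when (does P?) x ≤ when (does P?) y
when-does-mono-≤ (yes p) x≤y = x≤y p
when-does-mono-≤ (no _) x≤y = ≤-refl

when-does-≤ : ∀ {P : Set} (P? : Dec P) {x y} → 0ℚ ≤ y → (P → x ≤ y) → when (does P?) x ≤ y
when-does-≤ (yes p) 0≤y x≤y = x≤y p
when-does-≤ (no _) 0≤y x≤y = 0≤y

*-when : ∀ b c x → c * when b x ≡ when b (c * x)
*-when true c x = refl
*-when false c x = *-zeroʳ c

infixr 9 ∑
∑ : List A → (A → ℚ) → ℚ
∑ xs f = sumℚ (map f xs)
syntax ∑ xs (λ x → e) = ∑[ x ∈ xs ] e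

∑-cong : ∀ xs {f g : A → ℚ} → (∀ x → f x ≡ g x) → ∑ xs f ≡ ∑ xs g
∑-cong [] f≡g = refl
∑-cong (x ∷ xs) f≡g = cong₂ _+_ (f≡g x) (∑-cong xs f≡g)

∑-mono-≤ : ∀ xs {f g : A → ℚ} → (∀ x → f x ≤ g x) → ∑ xs f ≤ ∑ xs g
∑-mono-≤ [] f≤g = ≤-refl
∑-mono-≤ (x ∷ xs) f≤g = +-mono-≤ (f≤g x) (∑-mono-≤ xs f≤g)

∑-0≤ : ∀ xs {f : A → ℚ} → (∀ x → 0ℚ ≤ f x) → 0ℚ ≤ ∑ xs f
∑-0≤ [] 0≤f = ≤-refl
∑-0≤ (x ∷ xs) 0≤f = +-0≤ (0≤f x) (∑-0≤ xs 0≤f)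

∑-++ : ∀ xs ys (f : A → ℚ) → ∑ (xs ++ ys) f ≡ ∑ xs f + ∑ ys f
∑-++ [] ys f = sym (+-identityˡ _)
∑-++ (x ∷ xs) ys f = trans (cong (f x +_) (∑-++ xs ys f)) (sym (+-assoc (f x) _ _))

∑-map : ∀ (g : B → A) xs (f : A → ℚ) → ∑ (map g xs) f ≡ ∑ xs (λ x → f (g x))
∑-map g [] f = refl
∑-map g (x ∷ xs) f = cong (f (g x) +_) (∑-map g xs f)

∑-+ : ∀ xs (f g : A → ℚ) → ∑ xs (λ x → f x + g x) ≡ ∑ xs f + ∑ xs g
∑-+ [] f g = sym (+-identityˡ 0ℚ)
∑-+ (x ∷ xs) f g = trans (cong (f x + g x +_) (∑-+ xs f g)) (interchange (f x) (g x) (∑ xs f) (∑ xs g))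
  where
  open +-*-Solver
  interchange : ∀ a b c d → (a + b) + (c + d) ≡ (a + c) + (b + d)
  interchange = solve 4 (λ a b c d → (a :+ b) :+ (c :+ d) := (a :+ c) :+ (b :+ d)) refl

∑-*ˡ : ∀ xs c (f : A → ℚ) → ∑ xs (λ x → c * f x) ≡ c * ∑ xs f
∑-*ˡ [] c f = sym (*-zeroʳ c)
∑-*ˡ (x ∷ xs) c f = trans (cong (c * f x +_) (∑-*ˡ xs c f)) (sym (*-distribˡ-+ c (f x) _))

∑-const : ∀ (xs : List A) c → ∑ xs (λ _ → c) ≡ fromℕ (length xs) * c
∑-const [] c = sym (*-zeroˡ c)
∑-const (x ∷ xs) c = begin
  c + ∑ xs (λ _ → c)              ≡⟨ cong (c +_) (∑-const xs c) ⟩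
  c + fromℕ (length xs) * c       ≡⟨ cong (_+ fromℕ (length xs) * c) (sym (*-identityˡ c)) ⟩
  1ℚ * c + fromℕ (length xs) * c  ≡⟨ sym (*-distribʳ-+ c 1ℚ (fromℕ (length xs))) ⟩
  (1ℚ + fromℕ (length xs)) * c    ≡⟨ cong (_* c) (sym (fromℕ-suc (length xs))) ⟩
  fromℕ (suc (length xs)) * c     ∎
  where open ≡-Reasoning

∑-0 : ∀ (xs : List A) → ∑ xs (λ _ → 0ℚ) ≡ 0ℚ
∑-0 xs = trans (∑-const xs 0ℚ) (*-zeroʳ (fromℕ (length xs)))

∑-when : ∀ b xs (f : A → ℚ) → when b (∑ xs f) ≡ ∑ xs (λ x → when b (f x))
∑-when true xs f = refl
∑-when false xs f = sym (∑-0 xs)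

∑-swap : ∀ (xs : List A) (ys : List B) (f : A → B → ℚ) → ∑[ x ∈ xs ] ∑ ys (f x) ≡ ∑[ y ∈ ys ] ∑[ x ∈ xs ] f x y
∑-swap [] ys f = sym (∑-0 ys)
∑-swap (x ∷ xs) ys f = trans (cong (∑ ys (f x) +_) (∑-swap xs ys f)) (sym (∑-+ ys (f x) _))

∑-∑-when : ∀ (xs : List A) (ys : List B) (c : B → Bool) (f : A → B → ℚ) →
           ∑[ x ∈ xs ] ∑[ y ∈ ys ] when (c y) (f x y) ≡ ∑[ y ∈ ys ] when (c y) (∑[ x ∈ xs ] f x y)
∑-∑-when xs ys c f = trans (∑-swap xs ys (λ x y → when (c y) (f x y))) (∑-cong ys (λ y → sym (∑-when (c y) xs (λ x → f x y))))

∑-filter : ∀ {P : A → Set} (P? : Decidable P) xs (f : A → ℚ) →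
           ∑ (filter P? xs) f ≡ ∑ xs (λ x → when (does (P? x)) (f x))
∑-filter P? [] f = refl
∑-filter P? (x ∷ xs) f with does (P? x)
... | true = cong (f x +_) (∑-filter P? xs f)
... | false = trans (∑-filter P? xs f) (sym (+-identityˡ _))

∈⇒≤∑ : ∀ {x xs} (f : A → ℚ) → (∀ y → 0ℚ ≤ f y) → x ∈ₗ xs → f x ≤ ∑ xs f
∈⇒≤∑ {x = x} {xs = _ ∷ xs} f 0≤f (Any.here refl) = p≤p+q (f x) (∑-0≤ xs 0≤f)
∈⇒≤∑ {xs = y ∷ xs} f 0≤f (Any.there x∈xs) = ≤-trans (∈⇒≤∑ f 0≤f x∈xs) (p≤q+p (∑ xs f) (0≤f y))

∈⇒≤∑-when : ∀ {P : A → Set} (P? : Decidable P) {x xs} (f : A → ℚ) → (∀ y → 0ℚ ≤ f y) →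
            x ∈ₗ xs → P x → f x ≤ ∑[ y ∈ xs ] when (does (P? y)) (f y)
∈⇒≤∑-when P? {x} f 0≤f x∈xs Px =
  ≤-trans (≤-reflexive (cong (λ b → when b (f x)) (sym (dec-true (P? x) Px))))
          (∈⇒≤∑ (λ y → when (does (P? y)) (f y)) (λ y → when-0≤ (does (P? y)) (0≤f y)) x∈xs)

0<⇒≡suc : ∀ {m} → 0 ℕ.< m → ∃ λ j → m ≡ suc j
0<⇒≡suc (s≤s _) = _ , refl

Unique-⊆⇒length≤ : {xs ys : List A} → Unique xs → (∀ {x} → x ∈ₗ xs → x ∈ₗ ys) → length xs ℕ.≤ length ys
Unique-⊆⇒length≤ {xs = []} _ _ = z≤n
Unique-⊆⇒length≤ {xs = x ∷ xs} (x∉xs ∷ xs!) xs⊆ys with ys₁ , ys₂ , refl ← ∈-∃++ (xs⊆ys (Any.here refl)) =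
  ℕₚ.≤-trans (s≤s (Unique-⊆⇒length≤ xs! xs⊆ys₁ys₂)) (ℕₚ.≤-reflexive (sym (length-++-∷ ys₁)))
  where
  length-++-∷ : ∀ zs → length (zs ++ x ∷ ys₂) ≡ suc (length (zs ++ ys₂))
  length-++-∷ [] = refl
  length-++-∷ (_ ∷ zs) = cong suc (length-++-∷ zs)
  xs⊆ys₁ys₂ : ∀ {z} → z ∈ₗ xs → z ∈ₗ ys₁ ++ ys₂
  xs⊆ys₁ys₂ z∈xs with ∈-++⁻ ys₁ (xs⊆ys (Any.there z∈xs))
  ... | inj₁ z∈ys₁ = ∈-++⁺ˡ z∈ys₁
  ... | inj₂ (Any.here refl) = ⊥-elim (All.lookup x∉xs z∈xs refl)
  ... | inj₂ (Any.there z∈ys₂) = ∈-++⁺ʳ ys₁ z∈ys₂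

T-not : ∀ {b} → ¬ T b → T (not b)
T-not {true} ¬b = ¬b tt
T-not {false} ¬b = tt

T-not⁻ : ∀ {b} → T (not b) → ¬ T b
T-not⁻ {false} _ ()

infix 4 _≟ₛ_
_≟ₛ_ : DecidableEquality (Subset n)
_≟ₛ_ = ≡-dec Bool._≟_

⊆ᵇ⇒⊆ : {p q : Subset n} → T (p ⊆ᵇ q) → p ⊆ q
⊆ᵇ⇒⊆ {p = inside ∷ p} {inside ∷ q} p⊆ᵇq here = here
⊆ᵇ⇒⊆ {p = x ∷ p} {y ∷ q} p⊆ᵇq (there i∈p) = there (⊆ᵇ⇒⊆ (proj₂ (Equivalence.to T-∧ p⊆ᵇq)) i∈p)

⊆⇒⊆ᵇ : {p q : Subset n} → p ⊆ q → T (p ⊆ᵇ q)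
⊆⇒⊆ᵇ {p = []} {[]} p⊆q = tt
⊆⇒⊆ᵇ {p = inside ∷ p} {inside ∷ q} p⊆q = ⊆⇒⊆ᵇ (drop-∷-⊆ p⊆q)
⊆⇒⊆ᵇ {p = inside ∷ p} {outside ∷ q} p⊆q with () ← p⊆q here
⊆⇒⊆ᵇ {p = outside ∷ p} {y ∷ q} p⊆q = ⊆⇒⊆ᵇ (drop-∷-⊆ p⊆q)

Nonempty⇒nonemptyᵇ : {p : Subset n} → Nonempty p → T (nonemptyᵇ p)
Nonempty⇒nonemptyᵇ {p = inside ∷ p} _ = tt
Nonempty⇒nonemptyᵇ {p = outside ∷ p} (suc i , there i∈p) = Nonempty⇒nonemptyᵇ (i , i∈p)

nonemptyᵇ⇒Nonempty : {p : Subset n} → T (nonemptyᵇ p) → Nonempty p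
nonemptyᵇ⇒Nonempty {p = inside ∷ p} _ = zero , here
nonemptyᵇ⇒Nonempty {p = outside ∷ p} h with i , i∈p ← nonemptyᵇ⇒Nonempty {p = p} h = suc i , there i∈p

∈⇒∈ᵇ : {i : Fin n} {p : Subset n} → i ∈ p → T (i ∈ᵇ p)
∈⇒∈ᵇ i∈p = Equivalence.from T-≡ ([]=⇒lookup i∈p)

∈ᵇ⇒∈ : {i : Fin n} {p : Subset n} → T (i ∈ᵇ p) → i ∈ p
∈ᵇ⇒∈ {i = i} {p} i∈ᵇp = lookup⇒[]= i p (Equivalence.to T-≡ i∈ᵇp)

x∈p⇒⁅x⁆⊆p : {x : Fin n} {p : Subset n} → x ∈ p → ⁅ x ⁆ ⊆ p
x∈p⇒⁅x⁆⊆p {x = x} {p} x∈p y∈⁅x⁆ = subst (_∈ p) (sym (x∈⁅y⁆⇒x≡y x y∈⁅x⁆)) x∈p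

∪⁅⁆⊆ : {p q : Subset n} {x : Fin n} → p ⊆ q → x ∈ q → p ∪ ⁅ x ⁆ ⊆ q
∪⁅⁆⊆ {p = p} {q} {x} p⊆q x∈q y∈ with x∈p∪q⁻ p ⁅ x ⁆ y∈
... | inj₁ y∈p = p⊆q y∈p
... | inj₂ y∈⁅x⁆ = subst (_∈ q) (sym (x∈⁅y⁆⇒x≡y x y∈⁅x⁆)) x∈q

⊆⇒p∪q≡p : {p q : Subset n} → q ⊆ p → p ∪ q ≡ p
⊆⇒p∪q≡p {p = p} {q} q⊆p = ⊆-antisym p∪q⊆p (p⊆p∪q q)
  where
  p∪q⊆p : p ∪ q ⊆ p
  p∪q⊆p x∈ with x∈p∪q⁻ p q x∈
  ... | inj₁ x∈p = x∈p
  ... | inj₂ x∈q = q⊆p x∈q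

Nonempty⇒0<∣∣ : {p : Subset n} → Nonempty p → 0 ℕ.< ∣ p ∣
Nonempty⇒0<∣∣ (i , i∈p) = ℕₚ.≤-trans (ℕₚ.≤-reflexive (sym (∣⁅x⁆∣≡1 i))) (p⊆q⇒∣p∣≤∣q∣ (x∈p⇒⁅x⁆⊆p i∈p))

0<∣∣⇒Nonempty : {p : Subset n} → 0 ℕ.< ∣ p ∣ → Nonempty p
0<∣∣⇒Nonempty {n} {p} 0<∣p∣ with nonempty? p
... | yes ne = ne
... | no empty = contradiction (subst (λ q → 0 ℕ.< ∣ q ∣) (Empty-unique empty) 0<∣p∣) λ 0<∣⊥∣ → ℕₚ.<-irrefl (sym (∣⊥∣≡0 n)) 0<∣⊥∣

⊈⇒∃∉ : {p q : Subset n} → p ⊈ q → ∃ λ i → i ∈ p × i ∉ q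
⊈⇒∃∉ {p = []} {[]} p⊈q = ⊥-elim (p⊈q λ ())
⊈⇒∃∉ {p = inside ∷ p} {outside ∷ q} p⊈q = zero , here , λ ()
⊈⇒∃∉ {p = x ∷ p} {y ∷ q} p⊈q with p ⊆? q
... | no p⊈q′ with i , i∈p , i∉q ← ⊈⇒∃∉ p⊈q′ = suc i , there i∈p , λ i∈yq → i∉q (drop-there i∈yq)
... | yes p⊆q with x | y
...   | inside | inside = ⊥-elim (p⊈q (in⊆in p⊆q))
...   | inside | outside = zero , here , λ ()
...   | outside | _ = ⊥-elim (p⊈q (out⊆ p⊆q))

⊆∧∣∣≤⇒≡ : {p q : Subset n} → p ⊆ q → ∣ q ∣ ℕ.≤ ∣ p ∣ → p ≡ q
⊆∧∣∣≤⇒≡ {p = p} {q} p⊆q ∣q∣≤∣p∣ with q ⊆? p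
... | yes q⊆p = ⊆-antisym p⊆q q⊆p
... | no q⊈p = ⊥-elim (ℕₚ.<⇒≱ (p⊂q⇒∣p∣<∣q∣ (p⊆q , ⊈⇒∃∉ q⊈p)) ∣q∣≤∣p∣)

∣p∪q∣≡∣p∣+∣q─p∣ : (p q : Subset n) → ∣ p ∪ q ∣ ≡ ∣ p ∣ ℕ.+ ∣ q ─ p ∣
∣p∪q∣≡∣p∣+∣q─p∣ [] [] = refl
∣p∪q∣≡∣p∣+∣q─p∣ (inside ∷ p) (inside ∷ q) = cong suc (∣p∪q∣≡∣p∣+∣q─p∣ p q)
∣p∪q∣≡∣p∣+∣q─p∣ (inside ∷ p) (outside ∷ q) = cong suc (∣p∪q∣≡∣p∣+∣q─p∣ p q)
∣p∪q∣≡∣p∣+∣q─p∣ (outside ∷ p) (inside ∷ q) = trans (cong suc (∣p∪q∣≡∣p∣+∣q─p∣ p q)) (sym (ℕₚ.+-suc _ _))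
∣p∪q∣≡∣p∣+∣q─p∣ (outside ∷ p) (outside ∷ q) = ∣p∪q∣≡∣p∣+∣q─p∣ p q

∣p∣≡∣p∩q∣+∣p─q∣ : (p q : Subset n) → ∣ p ∣ ≡ ∣ p ∩ q ∣ ℕ.+ ∣ p ─ q ∣
∣p∣≡∣p∩q∣+∣p─q∣ [] [] = refl
∣p∣≡∣p∩q∣+∣p─q∣ (inside ∷ p) (inside ∷ q) = cong suc (∣p∣≡∣p∩q∣+∣p─q∣ p q)
∣p∣≡∣p∩q∣+∣p─q∣ (inside ∷ p) (outside ∷ q) = trans (cong suc (∣p∣≡∣p∩q∣+∣p─q∣ p q)) (sym (ℕₚ.+-suc _ _))
∣p∣≡∣p∩q∣+∣p─q∣ (outside ∷ p) (inside ∷ q) = ∣p∣≡∣p∩q∣+∣p─q∣ p q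
∣p∣≡∣p∩q∣+∣p─q∣ (outside ∷ p) (outside ∷ q) = ∣p∣≡∣p∩q∣+∣p─q∣ p q

∣p∪q∣≤∣p∣+∣q∣ : (p q : Subset n) → ∣ p ∪ q ∣ ℕ.≤ ∣ p ∣ ℕ.+ ∣ q ∣
∣p∪q∣≤∣p∣+∣q∣ p q = ℕₚ.≤-trans (ℕₚ.≤-reflexive (∣p∪q∣≡∣p∣+∣q─p∣ p q)) (ℕₚ.+-monoʳ-≤ ∣ p ∣ (∣p─q∣≤∣p∣ q p))

⊈⇒0<∣p─q∣ : {p q : Subset n} → p ⊈ q → 0 ℕ.< ∣ p ─ q ∣
⊈⇒0<∣p─q∣ p⊈q with i , i∈p , i∉q ← ⊈⇒∃∉ p⊈q = Nonempty⇒0<∣∣ (i , x∈p∧x∉q⇒x∈p─q i∈p i∉q)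

∣p∪⁅x⁆∣≡1+∣p∣ : ∀ (p : Subset n) {x} → x ∉ p → ∣ p ∪ ⁅ x ⁆ ∣ ≡ suc ∣ p ∣
∣p∪⁅x⁆∣≡1+∣p∣ (outside ∷ p) {zero} _ = cong (suc ∘ ∣_∣) (∪-identityʳ p)
∣p∪⁅x⁆∣≡1+∣p∣ (inside ∷ p) {zero} x∉p = ⊥-elim (x∉p here)
∣p∪⁅x⁆∣≡1+∣p∣ (inside ∷ p) {suc x} x∉p = cong suc (∣p∪⁅x⁆∣≡1+∣p∣ p (x∉p ∘ there))
∣p∪⁅x⁆∣≡1+∣p∣ (outside ∷ p) {suc x} x∉p = ∣p∪⁅x⁆∣≡1+∣p∣ p (x∉p ∘ there)

∈-⋃⁻ : ∀ {i : Fin n} ps → i ∈ ⋃ ps → ∃ λ p → p ∈ₗ ps × i ∈ p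
∈-⋃⁻ [] i∈⊥ = ⊥-elim (∉⊥ i∈⊥)
∈-⋃⁻ (p ∷ ps) i∈ with x∈p∪q⁻ p (⋃ ps) i∈
... | inj₁ i∈p = p , Any.here refl , i∈p
... | inj₂ i∈⋃ps with q , q∈ps , i∈q ← ∈-⋃⁻ ps i∈⋃ps = q , Any.there q∈ps , i∈q

⊆⋃ : ∀ {p : Subset n} {ps} → p ∈ₗ ps → p ⊆ ⋃ ps
⊆⋃ {ps = q ∷ ps} (Any.here refl) = p⊆p∪q (⋃ ps)
⊆⋃ {ps = q ∷ ps} (Any.there p∈ps) = q⊆p∪q q (⋃ ps) ∘ ⊆⋃ p∈ps

∣⋃∣≤ : ∀ {r} (ps : List (Subset n)) → All (λ p → ∣ p ∣ ℕ.≤ r) ps → ∣ ⋃ ps ∣ ℕ.≤ length ps ℕ.* r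
∣⋃∣≤ {n} [] [] = ℕₚ.≤-reflexive (∣⊥∣≡0 n)
∣⋃∣≤ (p ∷ ps) (∣p∣≤r ∷ ∣ps∣≤r) = ℕₚ.≤-trans (∣p∪q∣≤∣p∣+∣q∣ p (⋃ ps)) (ℕₚ.+-mono-≤ ∣p∣≤r (∣⋃∣≤ ps ∣ps∣≤r))

length-filter-tabulate : ∀ {m} (b : Fin n → Bool) (f : Fin m → Fin n) →
                         length (filter (λ i → b i Bool.≟ true) (tabulate f)) ≡ ∣ Vec.tabulate (b ∘ f) ∣
length-filter-tabulate {m = zero} b f = refl
length-filter-tabulate {m = suc m} b f with b (f zero)
... | true = cong suc (length-filter-tabulate b (f ∘ suc))
... | false = length-filter-tabulate b (f ∘ suc)

subsetsOf : Subset n → List (Subset n)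
subsetsOf [] = [] ∷ []
subsetsOf (inside ∷ p) = map (inside ∷_) (subsetsOf p) ++ map (outside ∷_) (subsetsOf p)
subsetsOf (outside ∷ p) = map (outside ∷_) (subsetsOf p)

length-subsetsOf : (p : Subset n) → length (subsetsOf p) ≡ 2 ^ ∣ p ∣
length-subsetsOf [] = refl
length-subsetsOf (inside ∷ p) = begin
  length (map (inside ∷_) (subsetsOf p) ++ map (outside ∷_) (subsetsOf p))
    ≡⟨ length-++ (map (inside ∷_) (subsetsOf p)) ⟩
  length (map (inside ∷_) (subsetsOf p)) ℕ.+ length (map (outside ∷_) (subsetsOf p))
    ≡⟨ cong₂ ℕ._+_ (length-map (inside ∷_) (subsetsOf p)) (length-map (outside ∷_) (subsetsOf p)) ⟩
  length (subsetsOf p) ℕ.+ length (subsetsOf p)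
    ≡⟨ cong (λ k → k ℕ.+ k) (length-subsetsOf p) ⟩
  2 ^ ∣ p ∣ ℕ.+ 2 ^ ∣ p ∣
    ≡⟨ cong (2 ^ ∣ p ∣ ℕ.+_) (sym (ℕₚ.+-identityʳ _)) ⟩
  2 ^ ∣ inside ∷ p ∣ ∎
  where open ≡-Reasoning
length-subsetsOf (outside ∷ p) = trans (length-map (outside ∷_) (subsetsOf p)) (length-subsetsOf p)

⊆⇒∈subsetsOf : {p q : Subset n} → q ⊆ p → q ∈ₗ subsetsOf p
⊆⇒∈subsetsOf {p = []} {[]} _ = Any.here refl
⊆⇒∈subsetsOf {p = inside ∷ p} {inside ∷ q} q⊆p = ∈-++⁺ˡ (∈-map⁺ (inside ∷_) (⊆⇒∈subsetsOf (drop-∷-⊆ q⊆p)))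
⊆⇒∈subsetsOf {p = inside ∷ p} {outside ∷ q} q⊆p = ∈-++⁺ʳ _ (∈-map⁺ (outside ∷_) (⊆⇒∈subsetsOf (drop-∷-⊆ q⊆p)))
⊆⇒∈subsetsOf {p = outside ∷ p} {inside ∷ q} q⊆p with () ← q⊆p here
⊆⇒∈subsetsOf {p = outside ∷ p} {outside ∷ q} q⊆p = ∈-map⁺ (outside ∷_) (⊆⇒∈subsetsOf (drop-∷-⊆ q⊆p))

Unique⇒length≤2^∣∣ : {xs : List (Subset n)} (p : Subset n) → Unique xs → All (_⊆ p) xs → length xs ℕ.≤ 2 ^ ∣ p ∣
Unique⇒length≤2^∣∣ p xs! xs⊆p =
  ℕₚ.≤-trans (Unique-⊆⇒length≤ xs! (λ q∈xs → ⊆⇒∈subsetsOf (All.lookup xs⊆p q∈xs)))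
          (ℕₚ.≤-reflexive (length-subsetsOf p))

∈-allSubsets : (p : Subset n) → p ∈ₗ allSubsets n
∈-allSubsets [] = Any.here refl
∈-allSubsets (inside ∷ p) = ∈-++⁺ˡ (∈-map⁺ (inside ∷_) (∈-allSubsets p))
∈-allSubsets {suc n} (outside ∷ p) = ∈-++⁺ʳ (map (inside ∷_) (allSubsets n)) (∈-map⁺ (outside ∷_) (∈-allSubsets p))

∑-allSubsets-suc : (f : Subset (suc n) → ℚ) →
                   ∑ (allSubsets (suc n)) f ≡ ∑[ p ∈ allSubsets n ] f (inside ∷ p) + ∑[ p ∈ allSubsets n ] f (outside ∷ p)
∑-allSubsets-suc {n} f = trans (∑-++ (map (inside ∷_) (allSubsets n)) _ f)
                              (cong₂ _+_ (∑-map (inside ∷_) (allSubsets n) f) (∑-map (outside ∷_) (allSubsets n) f))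

∑-allSubsets-≡ : (q : Subset n) (x : ℚ) → ∑[ p ∈ allSubsets n ] when (does (q ≟ₛ p)) x ≡ x
∑-allSubsets-≡ [] x = +-identityʳ x
∑-allSubsets-≡ {suc n} (inside ∷ q) x = begin
  ∑[ p ∈ allSubsets (suc n) ] when (does ((inside ∷ q) ≟ₛ p)) x
    ≡⟨ ∑-allSubsets-suc (λ p → when (does ((inside ∷ q) ≟ₛ p)) x) ⟩
  ∑[ p ∈ allSubsets n ] when (does (q ≟ₛ p)) x + ∑[ p ∈ allSubsets n ] 0ℚ
    ≡⟨ cong₂ _+_ (∑-allSubsets-≡ q x) (∑-0 (allSubsets n)) ⟩
  x + 0ℚ
    ≡⟨ +-identityʳ x ⟩
  x ∎
  where open ≡-Reasoning
∑-allSubsets-≡ {suc n} (outside ∷ q) x = begin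
  ∑[ p ∈ allSubsets (suc n) ] when (does ((outside ∷ q) ≟ₛ p)) x
    ≡⟨ ∑-allSubsets-suc (λ p → when (does ((outside ∷ q) ≟ₛ p)) x) ⟩
  ∑[ p ∈ allSubsets n ] 0ℚ + ∑[ p ∈ allSubsets n ] when (does (q ≟ₛ p)) x
    ≡⟨ cong₂ _+_ (∑-0 (allSubsets n)) (∑-allSubsets-≡ q x) ⟩
  0ℚ + x
    ≡⟨ +-identityˡ x ⟩
  x ∎
  where open ≡-Reasoning

-- Outside the module below, since the constant K of the theorem may not depend on the hypergraph.
walkConst : ℕ → ℕ → ℕ → ℚ
walkConst r zero s = 1ℚ
walkConst r (suc m) s = fromℕ (2 ^ s) * (1ℚ + fromℕ r) * walkConst r m (s ℕ.+ r)

0≤walkConst : ∀ r m s → 0ℚ ≤ walkConst r m s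
0≤walkConst r zero s = 0≤1
0≤walkConst r (suc m) s = *-0≤ (*-0≤ (fromℕ-0≤ (2 ^ s)) (+-0≤ 0≤1 (fromℕ-0≤ r))) (0≤walkConst r m (s ℕ.+ r))

module _ {n N : ℕ} (γ : Fin N → Subset n) where
  open Hypergraph γ

  members : Subset N → List (Fin N)
  members V = filter (λ i → lookup V i Bool.≟ true) (allFin N)

  length-members : ∀ V → length (members V) ≡ ∣ V ∣
  length-members V = trans (length-filter-tabulate (lookup V) id) (cong ∣_∣ (tabulate∘lookup V))

  ∈-members⁺ : ∀ {V i} → i ∈ V → i ∈ₗ members V
  ∈-members⁺ {V} {i} i∈V = ∈-filter⁺ (λ i → lookup V i Bool.≟ true) (∈-allFin i) ([]=⇒lookup i∈V)

  ∈-members⁻ : ∀ {V i} → i ∈ₗ members V → i ∈ V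
  ∈-members⁻ {V} {i} i∈ = lookup⇒[]= i V (proj₂ (∈-filter⁻ (λ i → lookup V i Bool.≟ true) {xs = allFin N} i∈))

  γ⊆unionOf : ∀ {V i} → i ∈ V → γ i ⊆ unionOf V
  γ⊆unionOf i∈V = ⊆⋃ (∈-map⁺ γ (∈-members⁺ i∈V))

  ∈-unionOf⁻ : ∀ {V x} → x ∈ unionOf V → ∃ λ i → i ∈ V × x ∈ γ i
  ∈-unionOf⁻ {V} x∈ with p , p∈ , x∈p ← ∈-⋃⁻ (map γ (members V)) x∈ | ∈-map⁻ γ p∈
  ... | i , i∈ , refl = i , ∈-members⁻ i∈ , x∈p

  unionOf-∪⁅⁆ : ∀ T i → unionOf (T ∪ ⁅ i ⁆) ≡ unionOf T ∪ γ i
  unionOf-∪⁅⁆ T i = ⊆-antisym ⊆∪ ∪⊆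
    where
    ⊆∪ : unionOf (T ∪ ⁅ i ⁆) ⊆ unionOf T ∪ γ i
    ⊆∪ x∈ with j , j∈ , x∈γj ← ∈-unionOf⁻ {T ∪ ⁅ i ⁆} x∈ | x∈p∪q⁻ T ⁅ i ⁆ j∈
    ... | inj₁ j∈T = p⊆p∪q {p = unionOf T} (γ i) (γ⊆unionOf j∈T x∈γj)
    ... | inj₂ j∈⁅i⁆ rewrite x∈⁅y⁆⇒x≡y i j∈⁅i⁆ = q⊆p∪q (unionOf T) (γ i) x∈γj
    ∪⊆ : unionOf T ∪ γ i ⊆ unionOf (T ∪ ⁅ i ⁆)
    ∪⊆ x∈ with x∈p∪q⁻ (unionOf T) (γ i) x∈
    ... | inj₁ x∈∪T with j , j∈T , x∈γj ← ∈-unionOf⁻ {T} x∈∪T = γ⊆unionOf (p⊆p∪q {p = T} ⁅ i ⁆ j∈T) x∈γj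
    ... | inj₂ x∈γi = γ⊆unionOf (q⊆p∪q T ⁅ i ⁆ (x∈⁅x⁆ i)) x∈γi

  ∣unionOf∣≤ : ∀ {r} → (∀ i → ∣ γ i ∣ ℕ.≤ r) → ∀ V → ∣ unionOf V ∣ ℕ.≤ ∣ V ∣ ℕ.* r
  ∣unionOf∣≤ {r} ∣γ∣≤r V = begin
    ∣ unionOf V ∣                           ≤⟨ ∣⋃∣≤ (map γ (members V)) (All.map⁺ (All.universal (λ i → ∣γ∣≤r i) (members V))) ⟩
    length (map γ (members V)) ℕ.* r        ≡⟨ cong (ℕ._* r) (trans (length-map γ (members V)) (length-members V)) ⟩
    ∣ V ∣ ℕ.* r                             ∎
    where open ℕₚ.≤-Reasoning

  module _ (γ-injective : Injective _≡_ _≡_ γ) where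

    length-filter-edges≤ : ∀ {P : Fin N → Set} (P? : Decidable P) S → (∀ {i} → P i → γ i ⊆ S) →
                           length (filter P? (allFin N)) ℕ.≤ 2 ^ ∣ S ∣
    length-filter-edges≤ P? S P⇒⊆ = ℕₚ.≤-trans (ℕₚ.≤-reflexive (sym (length-map γ (filter P? (allFin N)))))
      (Unique⇒length≤2^∣∣ S (Unique.map⁺ γ-injective (Unique.filter⁺ P? (Unique.allFin⁺ N)))
                             (All.map⁺ (All.map P⇒⊆ (All.all-filter P? (allFin N)))))

    ∣∣≤2^∣unionOf∣ : ∀ V → ∣ V ∣ ℕ.≤ 2 ^ ∣ unionOf V ∣
    ∣∣≤2^∣unionOf∣ V = ℕₚ.≤-trans (ℕₚ.≤-reflexive (sym (length-members V)))
                         (length-filter-edges≤ (λ i → lookup V i Bool.≟ true) (unionOf V) (λ {i} e → γ⊆unionOf (lookup⇒[]= i V e)))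

    ∑-edges-inside≤ : ∀ S {c} → 0ℚ ≤ c → ∑[ i ∈ allFin N ] when (does (γ i ⊆? S)) c ≤ fromℕ (2 ^ ∣ S ∣) * c
    ∑-edges-inside≤ S {c} 0≤c = begin
      ∑[ i ∈ allFin N ] when (does (γ i ⊆? S)) c  ≡⟨ sym (∑-filter (λ i → γ i ⊆? S) (allFin N) (λ _ → c)) ⟩
      ∑[ i ∈ filter (λ i → γ i ⊆? S) (allFin N) ] c ≡⟨ ∑-const (filter (λ i → γ i ⊆? S) (allFin N)) c ⟩
      fromℕ (length (filter (λ i → γ i ⊆? S) (allFin N))) * c ≤⟨ *-monoʳ-≤-0≤ c 0≤c (fromℕ-mono-≤ (length-filter-edges≤ (λ i → γ i ⊆? S) S id)) ⟩
      fromℕ (2 ^ ∣ S ∣) * c ∎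
      where open ≤-Reasoning

  _~_ : Fin N → Fin N → Set
  i ~ j = T (adjᵇ i j)

  ~⇒≢ : ∀ {i j} → i ~ j → i ≢ j
  ~⇒≢ {i} {j} i~j i≡j = T-not⁻ (proj₁ (Equivalence.to (T-∧ {not ⌊ i Fin.≟ j ⌋}) i~j)) (fromWitness i≡j)

  ~⇒meet : ∀ {i j} → i ~ j → Nonempty (γ i ∩ γ j)
  ~⇒meet {i} {j} i~j = nonemptyᵇ⇒Nonempty (proj₂ (Equivalence.to (T-∧ {not ⌊ i Fin.≟ j ⌋}) i~j))

  ~-sym : ∀ {i j} → i ~ j → j ~ i
  ~-sym {i} {j} i~j = Equivalence.from T-∧
    ( T-not (λ j≡i → ~⇒≢ i~j (sym (toWitness j≡i)))
    , Nonempty⇒nonemptyᵇ (subst Nonempty (∩-comm (γ i) (γ j)) (~⇒meet i~j)) )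

  CutEdge : Subset N → Subset N → Set
  CutEdge V U = ∃₂ λ i j → i ∈ U × j ∈ V × j ∉ U × i ~ j

  Connected : Subset N → Set
  Connected V = ∀ {U} → U ⊂ V → Nonempty U → CutEdge V U

  private
    properᵇ : Subset N → Subset N → Bool
    properᵇ V U = U ⊆ᵇ V ∧ nonemptyᵇ U ∧ not (V ⊆ᵇ U)

    cutEdgeᵇ : Subset N → Subset N → Bool
    cutEdgeᵇ V U = any (λ i → (i ∈ᵇ U) ∧ any (λ j → (j ∈ᵇ V) ∧ not (j ∈ᵇ U) ∧ adjᵇ i j) (allFin N)) (allFin N)

    properᵇ⁺ : ∀ {U V} → U ⊂ V → Nonempty U → T (properᵇ V U)
    properᵇ⁺ (U⊆V , w , w∈V , w∉U) U≠∅ =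
      Equivalence.from T-∧ (⊆⇒⊆ᵇ U⊆V , Equivalence.from T-∧ (Nonempty⇒nonemptyᵇ U≠∅ , T-not (λ V⊆U → w∉U (⊆ᵇ⇒⊆ V⊆U w∈V))))

    properᵇ⁻ : ∀ {U V} → T (properᵇ V U) → U ⊂ V × Nonempty U
    properᵇ⁻ {U} {V} cut with U⊆V , rest ← Equivalence.to (T-∧ {U ⊆ᵇ V}) cut
                      with U≠∅ , V⊈U ← Equivalence.to (T-∧ {nonemptyᵇ U}) rest
      = (⊆ᵇ⇒⊆ U⊆V , ⊈⇒∃∉ (T-not⁻ V⊈U ∘ ⊆⇒⊆ᵇ)) , nonemptyᵇ⇒Nonempty U≠∅

    cutEdgeᵇ⁺ : ∀ {U V} → CutEdge V U → T (cutEdgeᵇ V U)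
    cutEdgeᵇ⁺ (i , j , i∈U , j∈V , j∉U , i~j) =
      Any.any⁺ _ (lose (∈-allFin i) (Equivalence.from T-∧ (∈⇒∈ᵇ i∈U ,
        Any.any⁺ _ (lose (∈-allFin j) (Equivalence.from T-∧ (∈⇒∈ᵇ j∈V , Equivalence.from T-∧ (T-not (j∉U ∘ ∈ᵇ⇒∈) , i~j)))))))

    cutEdgeᵇ⁻ : ∀ {U V} → T (cutEdgeᵇ V U) → CutEdge V U
    cutEdgeᵇ⁻ edge
      with i , i-ok ← Any.satisfied (Any.any⁻ _ (allFin N) edge)
      with i∈U , j-ok ← Equivalence.to T-∧ i-ok
      with j , ij-ok ← Any.satisfied (Any.any⁻ _ (allFin N) j-ok)
      with j∈V , rest ← Equivalence.to T-∧ ij-ok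
      with j∉U , i~j ← Equivalence.to T-∧ rest
      = i , j , ∈ᵇ⇒∈ i∈U , ∈ᵇ⇒∈ j∈V , T-not⁻ j∉U ∘ ∈⇒∈ᵇ , i~j

  connectedᵇ⇒Connected : ∀ {V} → T (connectedᵇ V) → Connected V
  connectedᵇ⇒Connected {V} connected {U} U⊂V U≠∅
    with Equivalence.to T-∨ (All.lookup (All.all⁺ _ (allSubsets N) connected) (∈-allSubsets U))
  ... | inj₁ ¬cut = contradiction (properᵇ⁺ U⊂V U≠∅) (T-not⁻ ¬cut)
  ... | inj₂ edge = cutEdgeᵇ⁻ edge

  Connected⇒connectedᵇ : ∀ {V} → Connected V → T (connectedᵇ V)
  Connected⇒connectedᵇ {V} connected = All.all⁻ _ (All.universal cut-ok (allSubsets N))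
    where
    cut-ok : ∀ U → T (not (properᵇ V U) ∨ cutEdgeᵇ V U)
    cut-ok U with T? (properᵇ V U)
    ... | yes cut = Equivalence.from T-∨ (inj₂ (cutEdgeᵇ⁺ (uncurry connected (properᵇ⁻ {U} cut))))
    ... | no ¬cut = Equivalence.from T-∨ (inj₁ (T-not ¬cut))

  ⁅⁆-Connected : ∀ v → Connected ⁅ v ⁆
  ⁅⁆-Connected v {U} (U⊆⁅v⁆ , w , w∈⁅v⁆ , w∉U) (u , u∈U) = ⊥-elim (w∉U (subst (_∈ U) (trans u≡v (sym w≡v)) u∈U))
    where
    u≡v = x∈⁅y⁆⇒x≡y v (U⊆⁅v⁆ u∈U)
    w≡v = x∈⁅y⁆⇒x≡y v w∈⁅v⁆

  Connected-∪⁅⁆ : ∀ {A x y} → Connected A → x ∉ A → y ∈ A → y ~ x → Connected (A ∪ ⁅ x ⁆)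
  Connected-∪⁅⁆ {A} {x} {y} A-connected x∉A y∈A y~x {U} (U⊆A∪x , w , w∈A∪x , w∉U) (u , u∈U) with A ⊆? U
  ... | yes A⊆U = y , x , A⊆U y∈A , q⊆p∪q A ⁅ x ⁆ (x∈⁅x⁆ x) , x∉U , y~x
    where
    x∉U : x ∉ U
    x∉U x∈U with x∈p∪q⁻ A ⁅ x ⁆ w∈A∪x
    ... | inj₁ w∈A = w∉U (A⊆U w∈A)
    ... | inj₂ w∈⁅x⁆ = w∉U (subst (_∈ U) (sym (x∈⁅y⁆⇒x≡y x w∈⁅x⁆)) x∈U)
  ... | no A⊈U with nonempty? (U ∩ A)
  ...   | yes U∩A≠∅ = edge-inside-A (⊈⇒∃∉ A⊈U)
    where
    edge-inside-A : ∃ (λ a → a ∈ A × a ∉ U) → CutEdge (A ∪ ⁅ x ⁆) U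
    edge-inside-A (a , a∈A , a∉U)
      with i , j , i∈U∩A , j∈A , j∉U∩A , i~j ← A-connected (p∩q⊆q U A , a , a∈A , a∉U ∘ proj₁ ∘ x∈p∩q⁻ U A) U∩A≠∅
      = i , j , proj₁ (x∈p∩q⁻ U A i∈U∩A) , p⊆p∪q ⁅ x ⁆ j∈A , (λ j∈U → j∉U∩A (x∈p∩q⁺ (j∈U , j∈A))) , i~j
  ...   | no U∩A=∅ = x , y , x∈U , p⊆p∪q ⁅ x ⁆ y∈A , (λ y∈U → U∩A=∅ (y , x∈p∩q⁺ (y∈U , y∈A))) , ~-sym y~x
    where
    x∈U : x ∈ U
    x∈U with x∈p∪q⁻ A ⁅ x ⁆ (U⊆A∪x u∈U)
    ... | inj₁ u∈A = ⊥-elim (U∩A=∅ (u , x∈p∩q⁺ (u∈U , u∈A)))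
    ... | inj₂ u∈⁅x⁆ = subst (_∈ U) (x∈⁅y⁆⇒x≡y x u∈⁅x⁆) u∈U

  infixl 5 _∪ₗ_
  _∪ₗ_ : Subset N → List (Fin N) → Subset N
  A ∪ₗ xs = foldl (λ B x → B ∪ ⁅ x ⁆) A xs

  data Chain : Subset N → List (Fin N) → Set where
    [] : ∀ {A} → Chain A []
    step : ∀ {A x xs} y → x ∉ A → y ∈ A → y ~ x → Chain (A ∪ ⁅ x ⁆) xs → Chain A (x ∷ xs)

  Chain-Connected : ∀ {A xs} → Connected A → Chain A xs → Connected (A ∪ₗ xs)
  Chain-Connected A-connected [] = A-connected
  Chain-Connected A-connected (step y x∉A y∈A y~x chain) = Chain-Connected (Connected-∪⁅⁆ A-connected x∉A y∈A y~x) chain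

  ∣∪ₗ∣ : ∀ {A xs} → Chain A xs → ∣ A ∪ₗ xs ∣ ≡ ∣ A ∣ ℕ.+ length xs
  ∣∪ₗ∣ {A} [] = sym (ℕₚ.+-identityʳ ∣ A ∣)
  ∣∪ₗ∣ {A} {x ∷ xs} (step y x∉A y∈A y~x chain) = begin
    ∣ (A ∪ ⁅ x ⁆) ∪ₗ xs ∣             ≡⟨ ∣∪ₗ∣ chain ⟩
    ∣ A ∪ ⁅ x ⁆ ∣ ℕ.+ length xs        ≡⟨ cong (ℕ._+ length xs) (∣p∪⁅x⁆∣≡1+∣p∣ A x∉A) ⟩
    suc ∣ A ∣ ℕ.+ length xs            ≡⟨ sym (ℕₚ.+-suc ∣ A ∣ (length xs)) ⟩
    ∣ A ∣ ℕ.+ length (x ∷ xs)          ∎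
    where open ≡-Reasoning

  Chain-++ : ∀ {A} xs {ys} → Chain A (xs ++ ys) → Chain A xs × Chain (A ∪ₗ xs) ys
  Chain-++ [] chain = [] , chain
  Chain-++ (x ∷ xs) (step y x∉A y∈A y~x chain) with xs-chain , ys-chain ← Chain-++ xs chain =
    step y x∉A y∈A y~x xs-chain , ys-chain

  spanning-Chain : ∀ {V} → Connected V → ∀ t {A} → A ⊆ V → Nonempty A → ∣ A ∣ ℕ.+ t ≡ ∣ V ∣ →
                   ∃ λ xs → length xs ≡ t × Chain A xs × A ∪ₗ xs ≡ V
  spanning-Chain V-connected zero {A} A⊆V _ ∣A∣≡∣V∣ =
    [] , refl , [] , ⊆∧∣∣≤⇒≡ A⊆V (ℕₚ.≤-reflexive (trans (sym ∣A∣≡∣V∣) (ℕₚ.+-identityʳ ∣ A ∣)))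
  spanning-Chain {V} V-connected (suc t) {A} A⊆V A≠∅ ∣A∣+t≡∣V∣ = adjoin (V-connected (A⊆V , ⊈⇒∃∉ V⊈A) A≠∅)
    where
    V⊈A : V ⊈ A
    V⊈A V⊆A = ℕₚ.<⇒≱ (ℕₚ.≤-trans (ℕₚ.m<m+n ∣ A ∣ (s≤s z≤n)) (ℕₚ.≤-reflexive ∣A∣+t≡∣V∣)) (p⊆q⇒∣p∣≤∣q∣ V⊆A)
    adjoin : CutEdge V A → ∃ λ xs → length xs ≡ suc t × Chain A xs × A ∪ₗ xs ≡ V
    adjoin (i , j , i∈A , j∈V , j∉A , i~j) =
      prepend (spanning-Chain V-connected t (∪⁅⁆⊆ A⊆V j∈V) (j , q⊆p∪q A ⁅ j ⁆ (x∈⁅x⁆ j)) ∣A∪j∣+t≡∣V∣)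
      where
      ∣A∪j∣+t≡∣V∣ : ∣ A ∪ ⁅ j ⁆ ∣ ℕ.+ t ≡ ∣ V ∣
      ∣A∪j∣+t≡∣V∣ = trans (cong (ℕ._+ t) (∣p∪⁅x⁆∣≡1+∣p∣ A j∉A)) (trans (sym (ℕₚ.+-suc ∣ A ∣ t)) ∣A∣+t≡∣V∣)
      prepend : (∃ λ xs → length xs ≡ t × Chain (A ∪ ⁅ j ⁆) xs × (A ∪ ⁅ j ⁆) ∪ₗ xs ≡ V) →
                ∃ λ xs → length xs ≡ suc t × Chain A xs × A ∪ₗ xs ≡ V
      prepend (xs , length≡t , chain , A∪xs≡V) = j ∷ xs , cong suc length≡t , step i j∉A i∈A i~j chain , A∪xs≡V

  isCk⇒∣∣≡ : ∀ {j V} → isCk j V ≡ true → ∣ V ∣ ≡ j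
  isCk⇒∣∣≡ {j} {V} V∈Cj = toWitness (proj₁ (Equivalence.to (T-∧ {⌊ ∣ V ∣ ℕ.≟ j ⌋}) (Equivalence.from T-≡ V∈Cj)))

  isCk⇒Connected : ∀ {j V} → isCk j V ≡ true → Connected V
  isCk⇒Connected {j} {V} V∈Cj = connectedᵇ⇒Connected (proj₂ (Equivalence.to (T-∧ {⌊ ∣ V ∣ ℕ.≟ j ⌋}) (Equivalence.from T-≡ V∈Cj)))

  isCk-intro : ∀ {j V} → ∣ V ∣ ≡ j → Connected V → isCk j V ≡ true
  isCk-intro ∣V∣≡j V-connected = Equivalence.to T-≡ (Equivalence.from T-∧ (fromWitness ∣V∣≡j , Connected⇒connectedᵇ V-connected))

  split-off-core : ∀ k₀ m {V} → isCk (suc k₀ ℕ.+ m) V ≡ true →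
                   ∃ λ W → isCk (suc k₀) W ≡ true × ∃ λ zs → length zs ≡ m × Chain W zs × W ∪ₗ zs ≡ V
  split-off-core k₀ m {V} V∈C = W , isCk-intro ∣W∣≡1+k₀ (Chain-Connected (⁅⁆-Connected v) ys-chain) , zs , length-zs , zs-chain , W∪zs≡V
    where
    ∣V∣≡ = isCk⇒∣∣≡ V∈C
    v∈V = 0<∣∣⇒Nonempty (subst (0 ℕ.<_) (sym ∣V∣≡) (s≤s z≤n))
    v = proj₁ v∈V
    spanning = spanning-Chain (isCk⇒Connected V∈C) (k₀ ℕ.+ m) (x∈p⇒⁅x⁆⊆p (proj₂ v∈V)) (v , x∈⁅x⁆ v)
                 (trans (cong (ℕ._+ (k₀ ℕ.+ m)) (∣⁅x⁆∣≡1 v)) (sym ∣V∣≡))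
    xs = proj₁ spanning
    length-xs = proj₁ (proj₂ spanning)
    ys = take k₀ xs
    zs = drop k₀ xs
    split = Chain-++ ys (subst (Chain ⁅ v ⁆) (sym (take++drop≡id k₀ xs)) (proj₁ (proj₂ (proj₂ spanning))))
    ys-chain = proj₁ split
    zs-chain = proj₂ split
    W = ⁅ v ⁆ ∪ₗ ys
    length-ys : length ys ≡ k₀
    length-ys = trans (length-take k₀ xs) (trans (cong (k₀ ℕ.⊓_) length-xs) (ℕₚ.m≤n⇒m⊓n≡m (ℕₚ.m≤m+n k₀ m)))
    length-zs : length zs ≡ m
    length-zs = trans (length-drop k₀ xs) (trans (cong (ℕ._∸ k₀) length-xs) (ℕₚ.m+n∸m≡n k₀ m))
    ∣W∣≡1+k₀ : ∣ W ∣ ≡ suc k₀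
    ∣W∣≡1+k₀ = trans (∣∪ₗ∣ ys-chain) (cong₂ ℕ._+_ (∣⁅x⁆∣≡1 v) length-ys)
    W∪zs≡V : W ∪ₗ zs ≡ V
    W∪zs≡V = trans (sym (foldl-++ _ ⁅ v ⁆ ys zs)) (trans (cong (⁅ v ⁆ ∪ₗ_) (take++drop≡id k₀ xs)) (proj₂ (proj₂ (proj₂ spanning))))

  module _ {r : ℕ} (∣γ∣≤r : ∀ i → ∣ γ i ∣ ℕ.≤ r) where

    ∣unionOf∣≤k*r : ∀ {k W} → isCk k W ≡ true → ∣ unionOf W ∣ ℕ.≤ k ℕ.* r
    ∣unionOf∣≤k*r {W = W} W∈Ck = subst (λ k → ∣ unionOf W ∣ ℕ.≤ k ℕ.* r) (isCk⇒∣∣≡ W∈Ck) (∣unionOf∣≤ ∣γ∣≤r W)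

    -- Pigeonhole: V has 1 + k₀ + 2 ^ ((1 + k₀) r) distinct edges, more than fit inside ⋃ W.
    union-grows : Injective _≡_ _≡_ γ → ∀ k₀ {V W} → isCk (suc k₀ ℕ.+ 2 ^ (suc k₀ ℕ.* r)) V ≡ true → isCk (suc k₀) W ≡ true →
                  unionOf V ≢ unionOf W
    union-grows γ-injective k₀ {V} {W} V∈C W∈C ∪V≡∪W = ℕₚ.<⇒≱ (ℕₚ.m<n+m m {suc k₀} (s≤s z≤n)) (begin
      suc k₀ ℕ.+ m            ≡⟨ sym (isCk⇒∣∣≡ V∈C) ⟩
      ∣ V ∣                   ≤⟨ ∣∣≤2^∣unionOf∣ γ-injective V ⟩
      2 ^ ∣ unionOf V ∣       ≡⟨ cong (λ U → 2 ^ ∣ U ∣) ∪V≡∪W ⟩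
      2 ^ ∣ unionOf W ∣       ≤⟨ ℕₚ.^-monoʳ-≤ 2 (∣unionOf∣≤k*r W∈C) ⟩
      m                       ∎)
      where
      open ℕₚ.≤-Reasoning
      m = 2 ^ (suc k₀ ℕ.* r)

  -- d j Ω is, by definition, length (filter (counted? j Ω) (allFin N)).
  Counted : ℕ → Subset n → Fin N → Set
  Counted j Ω i = (Ω ⊆ᵇ γ i ∧ ⌊ ∣ γ i ∣ ℕ.≟ ∣ Ω ∣ ℕ.+ j ⌋) ≡ true

  counted? : ∀ j Ω i → Dec (Counted j Ω i)
  counted? j Ω i = (Ω ⊆ᵇ γ i ∧ ⌊ ∣ γ i ∣ ℕ.≟ ∣ Ω ∣ ℕ.+ j ⌋) Bool.≟ true

  Expanding : Subset n → Fin N → Set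
  Expanding S i = γ i ⊈ S × Nonempty (γ i ∩ S)

  expanding? : ∀ S i → Dec (Expanding S i)
  expanding? S i = ¬? (γ i ⊆? S) ×-dec nonempty? (γ i ∩ S)

  ExpandingBy : Subset n → Subset n → ℕ → Fin N → Set
  ExpandingBy S Ω j i = Nonempty Ω × γ i ∩ S ≡ Ω × ∣ γ i ─ S ∣ ≡ suc j

  expandingBy? : ∀ S Ω j i → Dec (ExpandingBy S Ω j i)
  expandingBy? S Ω j i = nonempty? Ω ×-dec (γ i ∩ S ≟ₛ Ω) ×-dec (∣ γ i ─ S ∣ ℕ.≟ suc j)

  ExpandingBy⇒Counted : ∀ {S Ω j i} → ExpandingBy S Ω j i → Counted (suc j) Ω i
  ExpandingBy⇒Counted {S} {i = i} (_ , refl , ∣γi─S∣≡1+j) = Equivalence.to T-≡ (Equivalence.from T-∧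
    (⊆⇒⊆ᵇ (p∩q⊆p (γ i) S) , fromWitness (trans (∣p∣≡∣p∩q∣+∣p─q∣ (γ i) S) (cong (∣ γ i ∩ S ∣ ℕ.+_) ∣γi─S∣≡1+j))))

  module _ (p : ℚ) (0≤p : 0ℚ ≤ p) where

    D-terms : List ℚ
    D-terms = concatMap (λ j → map (weight j) (filter (λ Ω → nonemptyᵇ Ω Bool.≟ true) (allSubsets n))) (upTo n)
      where
      weight : ℕ → Subset n → ℚ
      weight j Ω = fromℕ (d (suc j) Ω) * p ^ℚ suc j

    0≤D : 0ℚ ≤ D p
    0≤D = maxℚ-0≤ D-terms

    d-weight≤D : ∀ j {Ω} → Nonempty Ω → fromℕ (d (suc j) Ω) * p ^ℚ suc j ≤ D p
    d-weight≤D j {Ω} Ω≠∅ = bound (j ℕ.<? n)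
      where
      too-big : ¬ j ℕ.< n → ∀ i → ¬ Counted (suc j) Ω i
      too-big j≮n i e = j≮n (ℕₚ.≤-trans (s≤s (ℕₚ.m≤n+m j ∣ Ω ∣))
                                 (ℕₚ.≤-trans (ℕₚ.≤-reflexive (sym (trans ∣γi∣≡ (ℕₚ.+-suc ∣ Ω ∣ j)))) (∣p∣≤n (γ i))))
        where ∣γi∣≡ = toWitness (proj₂ (Equivalence.to (T-∧ {Ω ⊆ᵇ γ i}) (Equivalence.from T-≡ e)))
      bound : Dec (j ℕ.< n) → fromℕ (d (suc j) Ω) * p ^ℚ suc j ≤ D p
      bound (yes j<n) = ∈⇒≤maxℚ {xs = D-terms} (∈-concatMap⁺ _ (lose (∈-upTo⁺ j<n) (∈-map⁺ _ Ω∈)))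
        where
        Ω∈ = ∈-filter⁺ (λ Ω′ → nonemptyᵇ Ω′ Bool.≟ true) (∈-allSubsets Ω) (Equivalence.to T-≡ (Nonempty⇒nonemptyᵇ Ω≠∅))
      bound (no j≮n) = ≤-trans (≤-reflexive (trans (cong (λ k → fromℕ k * p ^ℚ suc j) d≡0) (*-zeroˡ (p ^ℚ suc j)))) 0≤D
        where
        d≡0 : d (suc j) Ω ≡ 0
        d≡0 = cong length (filter-none (counted? (suc j) Ω) (All.universal (too-big j≮n) (allFin N)))

    ∑-expandingBy≤D : ∀ S Ω j → ∑[ i ∈ allFin N ] when (does (expandingBy? S Ω j i)) (p ^ℚ suc j) ≤ D p
    ∑-expandingBy≤D S Ω j = begin
      ∑[ i ∈ allFin N ] when (does (expandingBy? S Ω j i)) (p ^ℚ suc j)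
        ≡⟨ sym (∑-filter (expandingBy? S Ω j) (allFin N) (λ _ → p ^ℚ suc j)) ⟩
      ∑[ i ∈ filter (expandingBy? S Ω j) (allFin N) ] p ^ℚ suc j
        ≡⟨ ∑-const (filter (expandingBy? S Ω j) (allFin N)) (p ^ℚ suc j) ⟩
      fromℕ (length (filter (expandingBy? S Ω j) (allFin N))) * p ^ℚ suc j
        ≤⟨ count≤D (nonempty? Ω) ⟩
      D p ∎
      where
      open ≤-Reasoning
      count≤D : Dec (Nonempty Ω) → fromℕ (length (filter (expandingBy? S Ω j) (allFin N))) * p ^ℚ suc j ≤ D p
      count≤D (yes Ω≠∅) = ≤-trans
        (*-monoʳ-≤-0≤ (p ^ℚ suc j) (^ℚ-0≤ 0≤p (suc j)) (fromℕ-mono-≤ (length-mono-≤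
          (filter⁺ (expandingBy? S Ω j) (counted? (suc j) Ω) (λ { refl → ExpandingBy⇒Counted }) (sublist-refl {x = allFin N})))))
        (d-weight≤D j Ω≠∅)
      count≤D (no Ω=∅) = ≤-trans
        (≤-reflexive (trans (cong (λ xs → fromℕ (length xs) * p ^ℚ suc j)
                                  (filter-none (expandingBy? S Ω j) (All.universal (λ i → Ω=∅ ∘ proj₁) (allFin N))))
                            (*-zeroˡ (p ^ℚ suc j))))
        0≤D

    -- Sum over the walks of m steps from the index set T with vertex set S: a step adds an edge
    -- γ i that lies inside S or expands S, the flag g records whether some step has expanded,
    -- and φ weighs the final state.
    walkSum : ℕ → (Subset N → Subset n → Bool → ℚ) → Subset N → Subset n → Bool → ℚ
    walkSum zero φ T S g = φ T S g
    walkSum (suc m) φ T S g =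
      ∑[ i ∈ allFin N ] when (does (γ i ⊆? S)) (walkSum m φ (T ∪ ⁅ i ⁆) S g) +
      ∑[ i ∈ allFin N ] when (does (expanding? S i)) (walkSum m φ (T ∪ ⁅ i ⁆) (S ∪ γ i) true)

    walkSum-0≤ : ∀ {φ} → (∀ T S g → 0ℚ ≤ φ T S g) → ∀ m T S g → 0ℚ ≤ walkSum m φ T S g
    walkSum-0≤ 0≤φ zero T S g = 0≤φ T S g
    walkSum-0≤ 0≤φ (suc m) T S g =
      +-0≤ (∑-0≤ (allFin N) (λ i → when-0≤ (does (γ i ⊆? S)) (walkSum-0≤ 0≤φ m (T ∪ ⁅ i ⁆) S g)))
           (∑-0≤ (allFin N) (λ i → when-0≤ (does (expanding? S i)) (walkSum-0≤ 0≤φ m (T ∪ ⁅ i ⁆) (S ∪ γ i) true)))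

    walkSum-mono-≤ : ∀ {φ ψ} → (∀ T S g → φ T S g ≤ ψ T S g) → ∀ m T S g → walkSum m φ T S g ≤ walkSum m ψ T S g
    walkSum-mono-≤ φ≤ψ zero T S g = φ≤ψ T S g
    walkSum-mono-≤ φ≤ψ (suc m) T S g =
      +-mono-≤ (∑-mono-≤ (allFin N) (λ i → when-mono-≤ (does (γ i ⊆? S)) (walkSum-mono-≤ φ≤ψ m (T ∪ ⁅ i ⁆) S g)))
               (∑-mono-≤ (allFin N) (λ i → when-mono-≤ (does (expanding? S i)) (walkSum-mono-≤ φ≤ψ m (T ∪ ⁅ i ⁆) (S ∪ γ i) true)))

    ∑-walkSum : ∀ (xs : List A) (φ : A → Subset N → Subset n → Bool → ℚ) m T S g →
                ∑[ a ∈ xs ] walkSum m (φ a) T S g ≡ walkSum m (λ T S g → ∑[ a ∈ xs ] φ a T S g) T S g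
    ∑-walkSum xs φ zero T S g = refl
    ∑-walkSum xs φ (suc m) T S g = begin
      ∑[ a ∈ xs ] walkSum (suc m) (φ a) T S g
        ≡⟨ ∑-+ xs _ _ ⟩
      ∑[ a ∈ xs ] ∑[ i ∈ allFin N ] when (does (γ i ⊆? S)) (walkSum m (φ a) (T ∪ ⁅ i ⁆) S g) +
      ∑[ a ∈ xs ] ∑[ i ∈ allFin N ] when (does (expanding? S i)) (walkSum m (φ a) (T ∪ ⁅ i ⁆) (S ∪ γ i) true)
        ≡⟨ cong₂ _+_ (∑-∑-when xs (allFin N) (λ i → does (γ i ⊆? S)) (λ a i → walkSum m (φ a) (T ∪ ⁅ i ⁆) S g))
                     (∑-∑-when xs (allFin N) (λ i → does (expanding? S i)) (λ a i → walkSum m (φ a) (T ∪ ⁅ i ⁆) (S ∪ γ i) true)) ⟩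
      ∑[ i ∈ allFin N ] when (does (γ i ⊆? S)) (∑[ a ∈ xs ] walkSum m (φ a) (T ∪ ⁅ i ⁆) S g) +
      ∑[ i ∈ allFin N ] when (does (expanding? S i)) (∑[ a ∈ xs ] walkSum m (φ a) (T ∪ ⁅ i ⁆) (S ∪ γ i) true)
        ≡⟨ cong₂ _+_ (∑-cong (allFin N) (λ i → cong (when (does (γ i ⊆? S))) (∑-walkSum xs φ m (T ∪ ⁅ i ⁆) S g)))
                     (∑-cong (allFin N) (λ i → cong (when (does (expanding? S i))) (∑-walkSum xs φ m (T ∪ ⁅ i ⁆) (S ∪ γ i) true))) ⟩
      walkSum (suc m) (λ T S g → ∑[ a ∈ xs ] φ a T S g) T S g ∎
      where open ≡-Reasoning

    grown : Subset N → Subset n → Bool → ℚ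
    grown T S g = when g (p ^ℚ ∣ S ∣)

    grownAt : Subset N → Subset N → Subset n → Bool → ℚ
    grownAt V T S g = when (does (T ≟ₛ V)) (grown T S g)

    0≤grown : ∀ T S g → 0ℚ ≤ grown T S g
    0≤grown T S g = when-0≤ g (^ℚ-0≤ 0≤p ∣ S ∣)

    0≤grownAt : ∀ V T S g → 0ℚ ≤ grownAt V T S g
    0≤grownAt V T S g = when-0≤ (does (T ≟ₛ V)) (0≤grown T S g)

    Chain⇒≤walkSum : ∀ {T zs} g → Chain T zs → g ≡ true ⊎ unionOf (T ∪ₗ zs) ≢ unionOf T →
                     p ^ℚ ∣ unionOf (T ∪ₗ zs) ∣ ≤ walkSum (length zs) (grownAt (T ∪ₗ zs)) T (unionOf T) g
    Chain⇒≤walkSum {T} true [] _ = ≤-reflexive (cong (λ b → when b (p ^ℚ ∣ unionOf T ∣)) (sym (dec-true (T ≟ₛ T) refl)))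
    Chain⇒≤walkSum false [] (inj₁ ())
    Chain⇒≤walkSum false [] (inj₂ grew) = ⊥-elim (grew refl)
    Chain⇒≤walkSum {T} {e ∷ zs} g (step y e∉T y∈T y~e chain) grew = walk-step (γ e ⊆? unionOf T)
      where
      V = (T ∪ ⁅ e ⁆) ∪ₗ zs
      φ = grownAt V
      m = length zs
      0≤φ = 0≤grownAt V
      stay = ∑[ i ∈ allFin N ] when (does (γ i ⊆? unionOf T)) (walkSum m φ (T ∪ ⁅ i ⁆) (unionOf T) g)
      expand = ∑[ i ∈ allFin N ] when (does (expanding? (unionOf T) i)) (walkSum m φ (T ∪ ⁅ i ⁆) (unionOf T ∪ γ i) true)
      walk-step : Dec (γ e ⊆ unionOf T) → p ^ℚ ∣ unionOf V ∣ ≤ stay + expand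
      walk-step (yes γe⊆T) = begin
        p ^ℚ ∣ unionOf V ∣                                   ≤⟨ Chain⇒≤walkSum g chain grew′ ⟩
        walkSum m φ (T ∪ ⁅ e ⁆) (unionOf (T ∪ ⁅ e ⁆)) g   ≡⟨ cong (λ S → walkSum m φ (T ∪ ⁅ e ⁆) S g) unchanged ⟩
        walkSum m φ (T ∪ ⁅ e ⁆) (unionOf T) g             ≤⟨ ∈⇒≤∑-when (λ i → γ i ⊆? unionOf T) (λ i → walkSum m φ (T ∪ ⁅ i ⁆) (unionOf T) g)
                                                                 (λ i → walkSum-0≤ 0≤φ m (T ∪ ⁅ i ⁆) (unionOf T) g) (∈-allFin e) γe⊆T ⟩
        stay                                               ≤⟨ p≤p+q stay (∑-0≤ (allFin N) (λ i → when-0≤ (does (expanding? (unionOf T) i))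
                                                                 (walkSum-0≤ 0≤φ m (T ∪ ⁅ i ⁆) (unionOf T ∪ γ i) true))) ⟩
        stay + expand                                     ∎
        where
        open ≤-Reasoning
        unchanged : unionOf (T ∪ ⁅ e ⁆) ≡ unionOf T
        unchanged = trans (unionOf-∪⁅⁆ T e) (⊆⇒p∪q≡p γe⊆T)
        grew′ : g ≡ true ⊎ unionOf V ≢ unionOf (T ∪ ⁅ e ⁆)
        grew′ = Data.Sum.map₂ (λ grew eq → grew (trans eq unchanged)) grew
      walk-step (no γe⊈T) = begin
        p ^ℚ ∣ unionOf V ∣                                   ≤⟨ Chain⇒≤walkSum true chain (inj₁ refl) ⟩
        walkSum m φ (T ∪ ⁅ e ⁆) (unionOf (T ∪ ⁅ e ⁆)) true ≡⟨ cong (λ S → walkSum m φ (T ∪ ⁅ e ⁆) S true) (unionOf-∪⁅⁆ T e) ⟩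
        walkSum m φ (T ∪ ⁅ e ⁆) (unionOf T ∪ γ e) true      ≤⟨ ∈⇒≤∑-when (expanding? (unionOf T)) (λ i → walkSum m φ (T ∪ ⁅ i ⁆) (unionOf T ∪ γ i) true)
                                                                 (λ i → walkSum-0≤ 0≤φ m (T ∪ ⁅ i ⁆) (unionOf T ∪ γ i) true) (∈-allFin e) (γe⊈T , meets) ⟩
        expand                                              ≤⟨ p≤q+p expand (∑-0≤ (allFin N) (λ i → when-0≤ (does (γ i ⊆? unionOf T))
                                                                 (walkSum-0≤ 0≤φ m (T ∪ ⁅ i ⁆) (unionOf T) g))) ⟩
        stay + expand                                     ∎
        where
        open ≤-Reasoning
        meets : Nonempty (γ e ∩ unionOf T)
        meets with x , x∈γy∩γe ← ~⇒meet y~e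
          = x , x∈p∩q⁺ (proj₂ (x∈p∩q⁻ (γ y) (γ e) x∈γy∩γe) , γ⊆unionOf y∈T (proj₁ (x∈p∩q⁻ (γ y) (γ e) x∈γy∩γe)))

    module _ {r : ℕ} (∣γ∣≤r : ∀ i → ∣ γ i ∣ ℕ.≤ r) where

      expanding-term≤ : ∀ S i → when (does (expanding? S i)) (p ^ℚ ∣ γ i ─ S ∣) ≤
                        ∑[ Ω ∈ subsetsOf S ] ∑[ j ∈ upTo r ] when (does (expandingBy? S Ω j i)) (p ^ℚ suc j)
      expanding-term≤ S i = when-does-≤ (expanding? S i) (∑-0≤ (subsetsOf S) (λ Ω → ∑-0≤ (upTo r) (λ j → 0≤term Ω j))) bound
        where
        term : Subset n → ℕ → ℚ
        term Ω j = when (does (expandingBy? S Ω j i)) (p ^ℚ suc j)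
        0≤term : ∀ Ω j → 0ℚ ≤ term Ω j
        0≤term Ω j = when-0≤ (does (expandingBy? S Ω j i)) (^ℚ-0≤ 0≤p (suc j))
        bound : Expanding S i → p ^ℚ ∣ γ i ─ S ∣ ≤ ∑[ Ω ∈ subsetsOf S ] ∑[ j ∈ upTo r ] term Ω j
        bound (γi⊈S , γi∩S≠∅) with j , ∣γi─S∣≡1+j ← 0<⇒≡suc (⊈⇒0<∣p─q∣ γi⊈S) = begin
          p ^ℚ ∣ γ i ─ S ∣                                 ≡⟨ cong (p ^ℚ_) ∣γi─S∣≡1+j ⟩
          p ^ℚ suc j                                       ≤⟨ ∈⇒≤∑-when (λ j′ → expandingBy? S (γ i ∩ S) j′ i) (λ j′ → p ^ℚ suc j′)
                                                                (λ j′ → ^ℚ-0≤ 0≤p (suc j′)) (∈-upTo⁺ j<r) (γi∩S≠∅ , refl , ∣γi─S∣≡1+j) ⟩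
          ∑[ j′ ∈ upTo r ] term (γ i ∩ S) j′                ≤⟨ ∈⇒≤∑ (λ Ω → ∑[ j′ ∈ upTo r ] term Ω j′) (λ Ω → ∑-0≤ (upTo r) (0≤term Ω))
                                                                (⊆⇒∈subsetsOf (p∩q⊆q (γ i) S)) ⟩
          ∑[ Ω ∈ subsetsOf S ] ∑[ j′ ∈ upTo r ] term Ω j′   ∎
          where
          open ≤-Reasoning
          j<r : j ℕ.< r
          j<r = ℕₚ.≤-trans (ℕₚ.≤-reflexive (sym ∣γi─S∣≡1+j)) (ℕₚ.≤-trans (∣p─q∣≤∣p∣ (γ i) S) (∣γ∣≤r i))

      ∑-expanding≤ : ∀ S → ∑[ i ∈ allFin N ] when (does (expanding? S i)) (p ^ℚ ∣ γ i ─ S ∣) ≤ fromℕ (2 ^ ∣ S ∣) * (fromℕ r * D p)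
      ∑-expanding≤ S = begin
        ∑[ i ∈ allFin N ] when (does (expanding? S i)) (p ^ℚ ∣ γ i ─ S ∣)
          ≤⟨ ∑-mono-≤ (allFin N) (expanding-term≤ S) ⟩
        ∑[ i ∈ allFin N ] ∑[ Ω ∈ subsetsOf S ] ∑[ j ∈ upTo r ] term Ω j i
          ≡⟨ ∑-swap (allFin N) (subsetsOf S) _ ⟩
        ∑[ Ω ∈ subsetsOf S ] ∑[ i ∈ allFin N ] ∑[ j ∈ upTo r ] term Ω j i
          ≡⟨ ∑-cong (subsetsOf S) (λ Ω → ∑-swap (allFin N) (upTo r) (λ i j → term Ω j i)) ⟩
        ∑[ Ω ∈ subsetsOf S ] ∑[ j ∈ upTo r ] ∑[ i ∈ allFin N ] term Ω j i
          ≤⟨ ∑-mono-≤ (subsetsOf S) (λ Ω → ∑-mono-≤ (upTo r) (∑-expandingBy≤D S Ω)) ⟩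
        ∑[ Ω ∈ subsetsOf S ] ∑[ j ∈ upTo r ] D p
          ≡⟨ ∑-cong (subsetsOf S) (λ _ → trans (∑-const (upTo r) (D p)) (cong (λ k → fromℕ k * D p) (length-upTo r))) ⟩
        ∑[ Ω ∈ subsetsOf S ] (fromℕ r * D p)
          ≡⟨ trans (∑-const (subsetsOf S) (fromℕ r * D p)) (cong (λ k → fromℕ k * (fromℕ r * D p)) (length-subsetsOf S)) ⟩
        fromℕ (2 ^ ∣ S ∣) * (fromℕ r * D p) ∎
        where
        open ≤-Reasoning
        term : Subset n → ℕ → Fin N → ℚ
        term Ω j i = when (does (expandingBy? S Ω j i)) (p ^ℚ suc j)

      module _ (γ-injective : Injective _≡_ _≡_ γ) where

        Λ : ℚ
        Λ = 1ℚ ⊔ D p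

        1≤Λ : 1ℚ ≤ Λ
        1≤Λ = p≤p⊔q 1ℚ (D p)

        D≤Λ : D p ≤ Λ
        D≤Λ = p≤q⊔p 1ℚ (D p)

        0≤Λ : 0ℚ ≤ Λ
        0≤Λ = ≤-trans 0≤1 1≤Λ

        -- The factor D p still owed by a walk that has not expanded yet.
        owed : Bool → ℚ
        owed true = 1ℚ
        owed false = D p

        0≤owed : ∀ g → 0ℚ ≤ owed g
        0≤owed true = 0≤1
        0≤owed false = 0≤D

        owed-step : ∀ g → owed g + fromℕ r * D p ≤ (1ℚ + fromℕ r) * (owed g * Λ)
        owed-step true = begin
          1ℚ + fromℕ r * D p          ≤⟨ +-mono-≤ 1≤Λ (*-monoˡ-≤-0≤ (fromℕ r) (fromℕ-0≤ r) D≤Λ) ⟩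
          Λ + fromℕ r * Λ             ≡⟨ distrib (fromℕ r) Λ ⟩
          (1ℚ + fromℕ r) * (1ℚ * Λ)   ∎
          where
          open ≤-Reasoning
          open +-*-Solver
          distrib : ∀ R L → L + R * L ≡ (1ℚ + R) * (1ℚ * L)
          distrib = solve 2 (λ R L → L :+ R :* L := (con 1ℚ :+ R) :* (con 1ℚ :* L)) refl
        owed-step false = begin
          D p + fromℕ r * D p                 ≤⟨ +-mono-≤ D≤DΛ (*-monoˡ-≤-0≤ (fromℕ r) (fromℕ-0≤ r) D≤DΛ) ⟩
          D p * Λ + fromℕ r * (D p * Λ)       ≡⟨ distrib (fromℕ r) (D p * Λ) ⟩
          (1ℚ + fromℕ r) * (D p * Λ)          ∎
          where
          open ≤-Reasoning
          open +-*-Solver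
          D≤DΛ : D p ≤ D p * Λ
          D≤DΛ = ≤-trans (≤-reflexive (sym (*-identityʳ (D p)))) (*-monoˡ-≤-0≤ (D p) 0≤D 1≤Λ)
          distrib : ∀ R X → X + R * X ≡ (1ℚ + R) * X
          distrib = solve 2 (λ R X → X :+ R :* X := (con 1ℚ :+ R) :* X) refl

        walkSum-grown≤ : ∀ m {s} T S g → ∣ S ∣ ℕ.≤ s → walkSum m grown T S g ≤ walkConst r m s * (owed g * Λ ^ℚ m) * p ^ℚ ∣ S ∣
        walkSum-grown≤ zero T S true _ = ≤-reflexive (sym (trans (cong (_* p ^ℚ ∣ S ∣) (*-identityˡ (1ℚ * 1ℚ))) (*-identityˡ (p ^ℚ ∣ S ∣))))
        walkSum-grown≤ zero T S false _ = *-0≤ (*-0≤ 0≤1 (*-0≤ 0≤D 0≤1)) (^ℚ-0≤ 0≤p ∣ S ∣)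
        walkSum-grown≤ (suc m) {s} T S g ∣S∣≤s = begin
          walkSum (suc m) grown T S g
            ≤⟨ +-mono-≤ stay≤ expand≤ ⟩
          a * (c * (w * L) * P) + (c * L * P) * (a * (R * D p))
            ≡⟨ regroup a c w L P R (D p) ⟩
          (a * (c * L * P)) * (w + R * D p)
            ≤⟨ *-mono-≤-0≤ (*-0≤ (fromℕ-0≤ (2 ^ s)) 0≤cLP) (+-0≤ (0≤owed g) (*-0≤ (fromℕ-0≤ r) 0≤D))
                           (*-monoʳ-≤-0≤ (c * L * P) 0≤cLP (fromℕ-mono-≤ (ℕₚ.^-monoʳ-≤ 2 ∣S∣≤s))) (owed-step g) ⟩
          (a′ * (c * L * P)) * ((1ℚ + R) * (w * Λ))
            ≡⟨ regroup′ a′ c w L P R Λ ⟩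
          walkConst r (suc m) s * (owed g * Λ ^ℚ suc m) * P ∎
          where
          open ≤-Reasoning
          open +-*-Solver
          a = fromℕ (2 ^ ∣ S ∣)
          a′ = fromℕ (2 ^ s)
          R = fromℕ r
          c = walkConst r m (s ℕ.+ r)
          w = owed g
          L = Λ ^ℚ m
          P = p ^ℚ ∣ S ∣
          0≤L = ^ℚ-0≤ 0≤Λ m
          0≤cLP = *-0≤ (*-0≤ (0≤walkConst r m (s ℕ.+ r)) 0≤L) (^ℚ-0≤ 0≤p ∣ S ∣)
          regroup : ∀ a c w L P R D → a * (c * (w * L) * P) + (c * L * P) * (a * (R * D)) ≡ (a * (c * L * P)) * (w + R * D)
          regroup = solve 7 (λ a c w L P R D → a :* (c :* (w :* L) :* P) :+ (c :* L :* P) :* (a :* (R :* D))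
                                              := (a :* (c :* L :* P)) :* (w :+ R :* D)) refl
          regroup′ : ∀ a′ c w L P R Λ → (a′ * (c * L * P)) * ((1ℚ + R) * (w * Λ)) ≡ a′ * (1ℚ + R) * c * (w * (Λ * L)) * P
          regroup′ = solve 7 (λ a′ c w L P R Λ → (a′ :* (c :* L :* P)) :* ((con 1ℚ :+ R) :* (w :* Λ))
                                               := a′ :* (con 1ℚ :+ R) :* c :* (w :* (Λ :* L)) :* P) refl
          ∣S∣≤s+r = ℕₚ.≤-trans ∣S∣≤s (ℕₚ.m≤m+n s r)
          ∣S∪γi∣≤s+r : ∀ i → ∣ S ∪ γ i ∣ ℕ.≤ s ℕ.+ r
          ∣S∪γi∣≤s+r i = ℕₚ.≤-trans (∣p∪q∣≤∣p∣+∣q∣ S (γ i)) (ℕₚ.+-mono-≤ ∣S∣≤s (∣γ∣≤r i))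
          stay≤ : ∑[ i ∈ allFin N ] when (does (γ i ⊆? S)) (walkSum m grown (T ∪ ⁅ i ⁆) S g) ≤ a * (c * (w * L) * P)
          stay≤ = ≤-trans (∑-mono-≤ (allFin N) (λ i → when-mono-≤ (does (γ i ⊆? S)) (walkSum-grown≤ m (T ∪ ⁅ i ⁆) S g ∣S∣≤s+r)))
                            (∑-edges-inside≤ γ-injective S (*-0≤ (*-0≤ (0≤walkConst r m (s ℕ.+ r)) (*-0≤ (0≤owed g) 0≤L)) (^ℚ-0≤ 0≤p ∣ S ∣)))
          split-power : ∀ i → c * (1ℚ * L) * p ^ℚ ∣ S ∪ γ i ∣ ≡ (c * L * P) * p ^ℚ ∣ γ i ─ S ∣
          split-power i = trans (cong (c * (1ℚ * L) *_) (trans (cong (p ^ℚ_) (∣p∪q∣≡∣p∣+∣q─p∣ S (γ i))) (^ℚ-+ p ∣ S ∣ ∣ γ i ─ S ∣)))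
                                (rearrange c L P (p ^ℚ ∣ γ i ─ S ∣))
            where
            rearrange : ∀ c L P Q → c * (1ℚ * L) * (P * Q) ≡ (c * L * P) * Q
            rearrange = solve 4 (λ c L P Q → c :* (con 1ℚ :* L) :* (P :* Q) := (c :* L :* P) :* Q) refl
          expand≤ : ∑[ i ∈ allFin N ] when (does (expanding? S i)) (walkSum m grown (T ∪ ⁅ i ⁆) (S ∪ γ i) true) ≤ (c * L * P) * (a * (R * D p))
          expand≤ = begin
            ∑[ i ∈ allFin N ] when (does (expanding? S i)) (walkSum m grown (T ∪ ⁅ i ⁆) (S ∪ γ i) true)
              ≤⟨ ∑-mono-≤ (allFin N) (λ i → when-mono-≤ (does (expanding? S i)) (walkSum-grown≤ m (T ∪ ⁅ i ⁆) (S ∪ γ i) true (∣S∪γi∣≤s+r i))) ⟩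
            ∑[ i ∈ allFin N ] when (does (expanding? S i)) (c * (1ℚ * L) * p ^ℚ ∣ S ∪ γ i ∣)
              ≡⟨ ∑-cong (allFin N) (λ i → trans (cong (when (does (expanding? S i))) (split-power i))
                                                (sym (*-when (does (expanding? S i)) (c * L * P) (p ^ℚ ∣ γ i ─ S ∣)))) ⟩
            ∑[ i ∈ allFin N ] ((c * L * P) * when (does (expanding? S i)) (p ^ℚ ∣ γ i ─ S ∣))
              ≡⟨ ∑-*ˡ (allFin N) (c * L * P) (λ i → when (does (expanding? S i)) (p ^ℚ ∣ γ i ─ S ∣)) ⟩
            (c * L * P) * ∑[ i ∈ allFin N ] when (does (expanding? S i)) (p ^ℚ ∣ γ i ─ S ∣)
              ≤⟨ *-monoˡ-≤-0≤ (c * L * P) 0≤cLP (∑-expanding≤ S) ⟩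
            (c * L * P) * (a * (R * D p)) ∎

        module _ (k₀ : ℕ) where

          private
            k = suc k₀
            m = 2 ^ (k ℕ.* r)
            k′ = k ℕ.+ m

          core? : ∀ W → Dec (isCk k W ≡ true)
          core? W = isCk k W Bool.≟ true

          p^∣unionOf∣≤∑-cores : ∀ {V} → isCk k′ V ≡ true →
                                p ^ℚ ∣ unionOf V ∣ ≤ ∑[ W ∈ allSubsets N ] when (does (core? W)) (walkSum m (grownAt V) W (unionOf W) false)
          p^∣unionOf∣≤∑-cores V∈Ck′ with W , W∈Ck , zs , length-zs , zs-chain , refl ← split-off-core k₀ m V∈Ck′ = begin
            p ^ℚ ∣ unionOf (W ∪ₗ zs) ∣
              ≤⟨ Chain⇒≤walkSum false zs-chain (inj₂ (union-grows ∣γ∣≤r γ-injective k₀ V∈Ck′ W∈Ck)) ⟩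
            walkSum (length zs) (grownAt (W ∪ₗ zs)) W (unionOf W) false
              ≡⟨ cong (λ j → walkSum j (grownAt (W ∪ₗ zs)) W (unionOf W) false) length-zs ⟩
            walkSum m (grownAt (W ∪ₗ zs)) W (unionOf W) false
              ≤⟨ ∈⇒≤∑-when core? (λ W′ → walkSum m (grownAt (W ∪ₗ zs)) W′ (unionOf W′) false)
                           (λ W′ → walkSum-0≤ (0≤grownAt _) m W′ (unionOf W′) false) (∈-allSubsets W) W∈Ck ⟩
            ∑[ W′ ∈ allSubsets N ] when (does (core? W′)) (walkSum m (grownAt (W ∪ₗ zs)) W′ (unionOf W′) false) ∎
            where open ≤-Reasoning

          Δ-as-sum : ∀ j → Δ p j ≡ ∑[ V ∈ allSubsets N ] when (does (isCk j V Bool.≟ true)) (p ^ℚ ∣ unionOf V ∣)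
          Δ-as-sum j = ∑-filter (λ V → isCk j V Bool.≟ true) (allSubsets N) (EX p)

          Δ-bound : Δ p k′ ≤ walkConst r m (k ℕ.* r) * (D p ⊔ D p ^ℚ k′) * Δ p k
          Δ-bound = begin
            Δ p k′
              ≡⟨ Δ-as-sum k′ ⟩
            ∑[ V ∈ allSubsets N ] when (does (isCk k′ V Bool.≟ true)) (p ^ℚ ∣ unionOf V ∣)
              ≤⟨ ∑-mono-≤ (allSubsets N) (λ V → when-does-≤ (isCk k′ V Bool.≟ true) (0≤walks V) p^∣unionOf∣≤∑-cores) ⟩
            ∑[ V ∈ allSubsets N ] ∑[ W ∈ allSubsets N ] when (does (core? W)) (walkSum m (grownAt V) W (unionOf W) false)
              ≡⟨ ∑-∑-when (allSubsets N) (allSubsets N) (does ∘ core?) (λ V W → walkSum m (grownAt V) W (unionOf W) false) ⟩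
            ∑[ W ∈ allSubsets N ] when (does (core? W)) (∑[ V ∈ allSubsets N ] walkSum m (grownAt V) W (unionOf W) false)
              ≡⟨ ∑-cong (allSubsets N) (λ W → cong (when (does (core? W))) (∑-walkSum (allSubsets N) grownAt m W (unionOf W) false)) ⟩
            ∑[ W ∈ allSubsets N ] when (does (core? W)) (walkSum m (λ T S g → ∑[ V ∈ allSubsets N ] grownAt V T S g) W (unionOf W) false)
              ≤⟨ ∑-mono-≤ (allSubsets N) (λ W → when-does-mono-≤ (core? W) (walk-bound W)) ⟩
            ∑[ W ∈ allSubsets N ] when (does (core? W)) (K * (D p * Λ′ ^ℚ m) * p ^ℚ ∣ unionOf W ∣)
              ≡⟨ ∑-cong (allSubsets N) (λ W → sym (*-when (does (core? W)) (K * (D p * Λ′ ^ℚ m)) (p ^ℚ ∣ unionOf W ∣))) ⟩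
            ∑[ W ∈ allSubsets N ] (K * (D p * Λ′ ^ℚ m) * when (does (core? W)) (p ^ℚ ∣ unionOf W ∣))
              ≡⟨ ∑-*ˡ (allSubsets N) (K * (D p * Λ′ ^ℚ m)) (λ W → when (does (core? W)) (p ^ℚ ∣ unionOf W ∣)) ⟩
            K * (D p * Λ′ ^ℚ m) * ∑[ W ∈ allSubsets N ] when (does (core? W)) (p ^ℚ ∣ unionOf W ∣)
              ≡⟨ cong (K * (D p * Λ′ ^ℚ m) *_) (sym (Δ-as-sum k)) ⟩
            K * (D p * Λ′ ^ℚ m) * Δ p k
              ≤⟨ *-monoʳ-≤-0≤ (Δ p k) 0≤Δ (*-monoˡ-≤-0≤ K (0≤walkConst r m (k ℕ.* r)) (x*[1⊔x]^m≤x⊔x^k 0≤D (ℕₚ.m<n+m m {k} (s≤s z≤n)))) ⟩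
            K * (D p ⊔ D p ^ℚ k′) * Δ p k ∎
            where
            open ≤-Reasoning
            K = walkConst r m (k ℕ.* r)
            Λ′ = Λ
            0≤walks : ∀ V → 0ℚ ≤ ∑[ W ∈ allSubsets N ] when (does (core? W)) (walkSum m (grownAt V) W (unionOf W) false)
            0≤walks V = ∑-0≤ (allSubsets N) (λ W → when-0≤ (does (core? W)) (walkSum-0≤ (0≤grownAt V) m W (unionOf W) false))
            0≤Δ : 0ℚ ≤ Δ p k
            0≤Δ = ∑-0≤ (filter (λ V → isCk k V Bool.≟ true) (allSubsets N)) (λ V → ^ℚ-0≤ 0≤p ∣ unionOf V ∣)
            walk-bound : ∀ W → isCk k W ≡ true →
                         walkSum m (λ T S g → ∑[ V ∈ allSubsets N ] grownAt V T S g) W (unionOf W) false ≤ K * (D p * Λ′ ^ℚ m) * p ^ℚ ∣ unionOf W ∣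
            walk-bound W W∈Ck = ≤-trans
              (walkSum-mono-≤ (λ T S g → ≤-reflexive (∑-allSubsets-≡ T (grown T S g))) m W (unionOf W) false)
              (walkSum-grown≤ m W (unionOf W) false (∣unionOf∣≤k*r ∣γ∣≤r W∈Ck))

lemma2p2 : (k r : ℕ) → k ≥ 1 → r ≥ 1 →
    Σ ℕ λ k′ → Σ ℚ λ K → k′ ≥ 1 ×
      ((p : ℚ) → 0ℚ < p → p < 1ℚ →
       (n N : ℕ) (γ : Fin N → Subset n) → Injective _≡_ _≡_ γ →
       ((i : Fin N) → ∣ γ i ∣ Data.Nat.≤ r) →
       Hypergraph.Δ γ p k′ ≤ K * (Hypergraph.D γ p ⊔ (Hypergraph.D γ p ^ℚ k′)) * Hypergraph.Δ γ p k)
lemma2p2 (suc k₀) r _ _ = suc k₀ ℕ.+ m , walkConst r m (suc k₀ ℕ.* r) , s≤s z≤n ,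
  λ p 0<p _ n N γ γ-injective ∣γ∣≤r → Δ-bound γ p (<⇒≤ 0<p) ∣γ∣≤r γ-injective k₀
  where m = 2 ^ (suc k₀ ℕ.* r)
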